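{- Suppose that there exists a finite projective plane $\Pi_q$ of order $q>4$. Then there exists a bipartite $$egr\bigl(2(q-1)^2,\, q-2,\, 6,\, (q-3)(q^2-9q+21)\bigr).$$
   Context: All graphs are simple, finite and connected. A $(k,g)$-graph is a $k$-regular graph of girth $g$. An edge-girth-regular graph $egr(n,k,g,\lambda)$ is a $(k,g)$-graph on $n$ vertices in which every edge is contained in exactly $\lambda$ distinct cycles of length $g$. -}

module Defs where

open import Data.Nat using (ℕ; zero; suc; _<_; _≤_)
open import Data.Fin using (Fin; _≟_)
open import Data.Bool using (Bool; true; false; _∧_; not; T)
open import Data.List using (List; []; _∷_)
open import Data.Bool.ListAction using (any)
open import Data.Vec using (Vec; toList)
open import Data.Product using (Σ; _×_; ∃)
open import Relation.Binary.PropositionalEquality using (_≡_; _≢_)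
open import Relation.Nullary using (¬_)
open import Relation.Nullary.Decidable using (⌊_⌋)
open import Function.Bundles using (_↔_)

record Graph (n : ℕ) : Set where
  field
    adj    : Fin n → Fin n → Bool
    sym    : ∀ u v → adj u v ≡ adj v u
    irrefl : ∀ u → adj u u ≡ false
open Graph public

module _ {n : ℕ} where

  _==_ : Fin n → Fin n → Bool
  x == y = ⌊ x ≟ y ⌋

  distinct : List (Fin n) → Bool
  distinct []       = true
  distinct (x ∷ xs) = not (any (x ==_) xs) ∧ distinct xs

  pathAdj : (Fin n → Fin n → Bool) → List (Fin n) → Bool
  pathAdj a []           = true
  pathAdj a (x ∷ [])     = true
  pathAdj a (x ∷ y ∷ xs) = a x y ∧ pathAdj a (y ∷ xs)

  lastOr : Fin n → List (Fin n) → Fin n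
  lastOr d []       = d
  lastOr d (x ∷ xs) = lastOr x xs

  isCycleL : (Fin n → Fin n → Bool) → List (Fin n) → Bool
  isCycleL a []       = false
  isCycleL a (x ∷ xs) = distinct (x ∷ xs) ∧ pathAdj a (x ∷ xs) ∧ a (lastOr x xs) x

  startsWith : Fin n → Fin n → List (Fin n) → Bool
  startsWith u v (x ∷ y ∷ _) = (x == u) ∧ (y == v)
  startsWith u v _           = false

HasCycle : ∀ {n} → Graph n → ℕ → Set
HasCycle {n} G m = 3 ≤ m × Σ (Vec (Fin n) m) (λ c → T (isCycleL (adj G) (toList c)))

HasGirth : ∀ {n} → Graph n → ℕ → Set
HasGirth G g = HasCycle G g × (∀ m → 3 ≤ m → m < g → ¬ HasCycle G m)

IsRegular : ∀ {n} → Graph n → ℕ → Set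
IsRegular {n} G k = ∀ v → Fin k ↔ Σ (Fin n) (λ w → T (adj G v w))

data Reach {n : ℕ} (G : Graph n) : Fin n → Fin n → Set where
  here : ∀ {u} → Reach G u u
  step : ∀ {u w v} → T (adj G u w) → Reach G w v → Reach G u v

IsConnected : ∀ {n} → Graph n → Set
IsConnected G = ∀ u v → Reach G u v

IsBipartite : ∀ {n} → Graph n → Set
IsBipartite {n} G = Σ (Fin n → Bool) (λ col → ∀ u v → T (adj G u v) → col u ≢ col v)

-- The g-cycles through the edge uv: each such cycle corresponds to exactly one
-- vertex sequence (u, v, v₂, …, v_{g-1}) of a cycle starting with u then v.
CyclesThrough : ∀ {n} → Graph n → ℕ → Fin n → Fin n → Set
CyclesThrough {n} G g u v =
  Σ (Vec (Fin n) g) (λ c → T (startsWith u v (toList c) ∧ isCycleL (adj G) (toList c)))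

IsEGR : ∀ n → Graph n → ℕ → ℕ → ℕ → Set
IsEGR n G k g lam =
  IsConnected G × IsRegular G k × HasGirth G g ×
  (∀ u v → T (adj G u v) → Fin lam ↔ CyclesThrough G g u v)

record ProjectivePlane (q : ℕ) : Set where
  field
    nPoints nLines : ℕ
    inc : Fin nPoints → Fin nLines → Bool
    line      : ∀ x y → x ≢ y → Fin nLines
    line-inc  : ∀ x y (x≢y : x ≢ y) → T (inc x (line x y x≢y)) × T (inc y (line x y x≢y))
    line-uniq : ∀ x y (x≢y : x ≢ y) l → T (inc x l) → T (inc y l) → l ≡ line x y x≢y
    meet      : ∀ l m → l ≢ m → Fin nPoints
    meet-inc  : ∀ l m (l≢m : l ≢ m) → T (inc (meet l m l≢m) l) × T (inc (meet l m l≢m) m)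
    meet-uniq : ∀ l m (l≢m : l ≢ m) x → T (inc x l) → T (inc x m) → x ≡ meet l m l≢m
    quad      : Fin 4 → Fin nPoints
    quad-inj  : ∀ i j → i ≢ j → quad i ≢ quad j
    quad-gen  : ∀ i j k → i ≢ j → i ≢ k → j ≢ k → ∀ l →
                ¬ (T (inc (quad i) l) × T (inc (quad j) l) × T (inc (quad k) l))
    order     : ∀ l → Fin (suc q) ↔ Σ (Fin nPoints) (λ x → T (inc x l))

{-# OPTIONS --safe #-}
-- Fix a triangle in a projective plane of order q and delete every point on one of its sides and
-- every line through one of its vertices. The incidence graph of the (q − 1)² remaining points and
-- (q − 1)² remaining lines is bipartite and (q − 2)-regular, and it has no 4-cycles since two points
-- lie on at most one line. A 6-cycle through an edge P ∈ ℓ is P, ℓ, P₂, P₂P₃, P₃, m with P₂ ∈ ℓ and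
-- P, P₃ ∈ m. Of the (q − 3)³ choices of (P₂, m, P₃), exactly those whose line P₂P₃ passes through a
-- vertex Z fail, and for fixed P₂ and Z these correspond to q − 4 points of the line P₂Z. Hence every
-- edge lies on (q − 3)((q − 3)² − 3(q − 4)) = (q − 3)(q² − 9q + 21) hexagons. Connectivity uses that
-- a line through exactly one vertex carries q − 1 ≥ 4 remaining points.
module Submission where

open import Data.Bool using (Bool; true; false; _∧_; not; T; if_then_else_)
open import Data.Bool.ListAction using (any)
open import Data.Bool.Properties using (T-irrelevant; T-∧; T?; not-involutive)
open import Data.Empty using (⊥; ⊥-elim)
open import Data.Fin using (Fin; zero; suc; _≟_; inject₁; fromℕ<)
open import Data.Fin.Patterns using (0F; 1F; 2F)
open import Data.Fin.Properties
  using (+↔⊎; *↔×; cantor-schröder-bernstein; all?; any?; inject₁-injective; ¬∀⟶∃¬; pigeonhole; <⇒≢)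
open import Data.List using (List; []; _∷_; length)
open import Data.List.Relation.Unary.All using (All; []; _∷_)
import Data.List.Relation.Unary.All as All
open import Data.List.Relation.Unary.AllPairs using ([]; _∷_)
import Data.List.Relation.Unary.AllPairs as AllPairs
import Data.List.Relation.Unary.AllPairs.Properties as AllPairs
open import Data.List.Relation.Unary.Linked using (Linked; []; [-]; _∷_; linked?)
import Data.List.Relation.Unary.Linked.Properties as Linked
open import Data.List.Relation.Unary.Unique.Propositional using (Unique)
import Data.List.Relation.Unary.Unique.Propositional.Properties as Unique
open import Data.Nat using (ℕ; zero; suc; _+_; _*_; _∸_; _≤_; _<_; z≤n; s≤s)
open import Data.Nat.Properties using (+-suc; +-identityʳ; m+n∸m≡n; m+n∸n≡m; ∸-+-assoc; ∸-monoˡ-<; m<n⇒0<n∸m; <-trans)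
open import Data.Nat.Tactic.RingSolver using (solve-∀)
open import Data.Product using (Σ; _×_; _,_; proj₁; proj₂; map₂)
open import Data.Product.Function.Dependent.Propositional using () renaming (cong to Σ-cong)
open import Data.Product.Function.NonDependent.Propositional using (_×-↔_)
open import Data.Sum using (_⊎_; inj₁; inj₂)
open import Data.Sum.Function.Propositional using (_⊎-↔_)
import Data.Sum.Properties as Sum
open import Data.Unit using (tt)
open import Data.Vec using ([]; _∷_; toList)
open import Function using (_∘_; _↔_; _⇔_; Inverse; Equivalence; Injection; mk↔ₛ′; mk⇔)
open import Function.Properties.Inverse using (↔-refl; ↔-sym; ↔-trans; ↔⇒↣)
open import Function.Related.Propositional using (bijection)
open import Relation.Binary.Construct.Closure.ReflexiveTransitive using (Star; ε; _◅_; _◅◅_)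
open import Relation.Binary.Definitions using (DecidableEquality)
open import Relation.Binary.PropositionalEquality
open import Relation.Nullary using (¬_; yes; no; ¬?)
open import Relation.Nullary.Decidable
  using (Dec; True; ⌊_⌋; _×-dec_; map′; decidable-stable; toWitness; fromWitness; toWitnessFalse; fromWitnessFalse)

open import Defs hiding (sym)

open Inverse using (to; from; strictlyInverseˡ; strictlyInverseʳ)

-- Counting finite sets

∧-intro : ∀ {a b} → T a → T b → T (a ∧ b)
∧-intro p q = Equivalence.from T-∧ (p , q)

∧-elim : ∀ {a b} → T (a ∧ b) → T a × T b
∧-elim = Equivalence.to T-∧

Σ-T-≡ : ∀ {A : Set} {P : A → Bool} {x y : Σ A (T ∘ P)} → proj₁ x ≡ proj₁ y → x ≡ y
Σ-T-≡ {x = a , p} {y = .a , p′} refl = cong (a ,_) (T-irrelevant p p′)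

Σ-T-≟ : ∀ {A : Set} {P : A → Bool} → DecidableEquality A → DecidableEquality (Σ A (T ∘ P))
Σ-T-≟ _≟ᴬ_ x y = map′ Σ-T-≡ (cong proj₁) (proj₁ x ≟ᴬ proj₁ y)

Σ-T-cong : ∀ {A : Set} {P Q : A → Bool} → (∀ a → T (P a) ⇔ T (Q a)) → Σ A (T ∘ P) ↔ Σ A (T ∘ Q)
Σ-T-cong P⇔Q = mk↔ₛ′ (map₂ (Equivalence.to (P⇔Q _))) (map₂ (Equivalence.from (P⇔Q _)))
  (λ _ → Σ-T-≡ refl) (λ _ → Σ-T-≡ refl)

Σ-T-assoc : ∀ {A : Set} (P Q : A → Bool) → Σ (Σ A (T ∘ P)) (T ∘ Q ∘ proj₁) ↔ Σ A (λ a → T (P a ∧ Q a))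
Σ-T-assoc {A} P Q = mk↔ₛ′ join split (λ _ → Σ-T-≡ refl) (λ _ → Σ-T-≡ (Σ-T-≡ refl))
  where
  join : Σ (Σ A (T ∘ P)) (T ∘ Q ∘ proj₁) → Σ A (λ a → T (P a ∧ Q a))
  join ((a , p) , q) = a , ∧-intro p q
  split : Σ A (λ a → T (P a ∧ Q a)) → Σ (Σ A (T ∘ P)) (T ∘ Q ∘ proj₁)
  split (a , pq) = (a , proj₁ (∧-elim pq)) , proj₂ (∧-elim pq)

to-injective : ∀ {A B : Set} (e : A ↔ B) {x y} → to e x ≡ to e y → x ≡ y
to-injective e {x} {y} = Injection.injective (↔⇒↣ e) {x} {y}

size-unique : ∀ {A : Set} {m n} → Fin m ↔ A → Fin n ↔ A → m ≡ n
size-unique e f = cantor-schröder-bernstein (to-injective (↔-trans e (↔-sym f))) (to-injective (↔-trans f (↔-sym e)))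

Σ-size : ∀ {A : Set} {B : A → Set} {m n} → Fin m ↔ A → (∀ a → Fin n ↔ B a) → Fin (m * n) ↔ Σ A B
Σ-size A↔ B↔ = ↔-trans *↔× (Σ-cong {k = bijection} A↔ (B↔ _))

private
  count : ∀ {n} → (Fin n → Bool) → ℕ
  count {zero}  Q = 0
  count {suc n} Q = (if Q zero then 1 else 0) + count (Q ∘ suc)

  count+count-not : ∀ {n} (Q : Fin n → Bool) → count Q + count (not ∘ Q) ≡ n
  count+count-not {zero}  Q = refl
  count+count-not {suc n} Q with Q zero
  ... | true  = cong suc (count+count-not (Q ∘ suc))
  ... | false = trans (+-suc (count (Q ∘ suc)) _) (cong suc (count+count-not (Q ∘ suc)))

  T-size : ∀ b → Fin (if b then 1 else 0) ↔ T b
  T-size true  = mk↔ₛ′ _ (λ _ → zero) (λ _ → refl) (λ { zero → refl })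
  T-size false = mk↔ₛ′ (λ ()) (λ ()) (λ ()) (λ ())

  Σ-Fin-suc : ∀ {n} (B : Fin (suc n) → Set) → (B zero ⊎ Σ (Fin n) (B ∘ suc)) ↔ Σ (Fin (suc n)) B
  Σ-Fin-suc B = mk↔ₛ′ (λ { (inj₁ b) → zero , b ; (inj₂ (i , b)) → suc i , b })
                      (λ { (zero , b) → inj₁ b ; (suc i , b) → inj₂ (i , b) })
                      (λ { (zero , b) → refl ; (suc i , b) → refl })
                      (λ { (inj₁ b) → refl ; (inj₂ (i , b)) → refl })

  count-size : ∀ {n} (Q : Fin n → Bool) → Fin (count Q) ↔ Σ (Fin n) (T ∘ Q)
  count-size {zero}  Q = mk↔ₛ′ (λ ()) (λ { (() , _) }) (λ { (() , _) }) (λ ())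
  count-size {suc n} Q = ↔-trans +↔⊎ (↔-trans (T-size (Q zero) ⊎-↔ count-size (Q ∘ suc)) (Σ-Fin-suc _))

Σ-T-reindex : ∀ {A B : Set} (e : B ↔ A) (Q : A → Bool) → Σ B (T ∘ Q ∘ to e) ↔ Σ A (T ∘ Q)
Σ-T-reindex e Q = Σ-cong {k = bijection} e ↔-refl

↔-complement : ∀ {A : Set} {n k} (Q : A → Bool) → Fin n ↔ A → Fin k ↔ Σ A (T ∘ Q) →
               Fin (n ∸ k) ↔ Σ A (T ∘ not ∘ Q)
↔-complement {n = n} {k} Q A↔ Q↔ =
  subst (λ m → Fin m ↔ _) count-not≡ (↔-trans (count-size (not ∘ Q′)) (Σ-T-reindex A↔ (not ∘ Q)))
  where
  Q′ = Q ∘ to A↔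
  count≡ : count Q′ ≡ k
  count≡ = size-unique (↔-trans (count-size Q′) (Σ-T-reindex A↔ Q)) Q↔
  count-not≡ : count (not ∘ Q′) ≡ n ∸ k
  count-not≡ = begin
    count (not ∘ Q′)                       ≡⟨ m+n∸m≡n (count Q′) _ ⟨
    count Q′ + count (not ∘ Q′) ∸ count Q′ ≡⟨ cong₂ _∸_ (count+count-not Q′) count≡ ⟩
    n ∸ k                                  ∎
    where open ≡-Reasoning

Σ-T-fibres : ∀ {A B : Set} {P : A → Bool} {Q : B → A → Bool} (f : ∀ a → T (P a) → B) →
             (∀ a p → T (Q (f a p) a)) → (∀ b a → T (Q b a) → Σ (T (P a)) (λ p → f a p ≡ b)) →
             Σ A (T ∘ P) ↔ Σ B (λ b → Σ A (T ∘ Q b))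
Σ-T-fibres {A} {B} {P} {Q} f in-fibre fibre-base = mk↔ₛ′ split glue split∘glue (λ _ → Σ-T-≡ refl)
  where
  split : Σ A (T ∘ P) → Σ B (λ b → Σ A (T ∘ Q b))
  split (a , p) = f a p , a , in-fibre a p
  glue : Σ B (λ b → Σ A (T ∘ Q b)) → Σ A (T ∘ P)
  glue (b , a , q) = a , proj₁ (fibre-base b a q)
  over : ∀ {a b b′} (q : T (Q b a)) (q′ : T (Q b′ a)) → b′ ≡ b → (b′ , a , q′) ≡ (b , a , q)
  over q q′ refl = cong (λ r → _ , _ , r) (T-irrelevant q′ q)
  split∘glue : ∀ z → split (glue z) ≡ z
  split∘glue (b , a , q) = over q _ (proj₂ (fibre-base b a q))

module _ {A : Set} (_≟ᴬ_ : DecidableEquality A) where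

  outside-family : ∀ {P : A → Bool} {m n} → m < n → Fin n ↔ Σ A (T ∘ P) →
                   (x : Fin m → A) → Σ A (λ a → T (P a) × ∀ i → a ≢ x i)
  outside-family {m = m} m<n P↔ x with any? (λ j → all? (λ i → ¬? (proj₁ (to P↔ j) ≟ᴬ x i)))
  ... | yes (j , outside) = proj₁ (to P↔ j) , proj₂ (to P↔ j) , outside
  ... | no none = ⊥-elim (<⇒≢ j₁<j₂ (to-injective P↔ (Σ-T-≡ (trans (proj₂ (hit j₁))
                                                             (trans (cong x same) (sym (proj₂ (hit j₂))))))))
    where
    hit : ∀ j → Σ (Fin m) (λ i → proj₁ (to P↔ j) ≡ x i)
    hit j = map₂ (decidable-stable (proj₁ (to P↔ j) ≟ᴬ x _))
                 (¬∀⟶∃¬ m _ (λ i → ¬? (proj₁ (to P↔ j) ≟ᴬ x i)) (λ outside → none (j , outside)))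
    collision = pigeonhole m<n (proj₁ ∘ hit)
    j₁ = proj₁ collision
    j₂ = proj₁ (proj₂ collision)
    j₁<j₂ = proj₁ (proj₂ (proj₂ collision))
    same = proj₂ (proj₂ (proj₂ collision))

  ↔-remove-one : ∀ {n} {P : A → Bool} {x} → T (P x) → Fin n ↔ Σ A (T ∘ P) →
                 Fin (n ∸ 1) ↔ Σ A (λ a → T (P a ∧ not ⌊ a ≟ᴬ x ⌋))
  ↔-remove-one {P = P} {x} px P↔ =
    ↔-trans (↔-complement (λ z → ⌊ proj₁ z ≟ᴬ x ⌋) P↔ singleton) (Σ-T-assoc P (λ a → not ⌊ a ≟ᴬ x ⌋))
    where
    singleton : Fin 1 ↔ Σ (Σ A (T ∘ P)) (λ z → T ⌊ proj₁ z ≟ᴬ x ⌋)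
    singleton = mk↔ₛ′ (λ _ → (x , px) , fromWitness refl) (λ _ → zero)
      (λ { ((y , _) , y≡x) → Σ-T-≡ (Σ-T-≡ (sym (toWitness y≡x))) }) (λ { zero → refl })

  ↔-remove : ∀ {n} {P R : A → Bool} (xs : List A) → Unique xs → All (T ∘ P) xs →
             (∀ a → T (R a) ⇔ (T (P a) × All (a ≢_) xs)) →
             Fin n ↔ Σ A (T ∘ P) → Fin (n ∸ length xs) ↔ Σ A (T ∘ R)
  ↔-remove [] _ _ R⇔ P↔ =
    ↔-trans P↔ (Σ-T-cong (λ a → mk⇔ (λ p → Equivalence.from (R⇔ a) (p , [])) (proj₁ ∘ Equivalence.to (R⇔ a))))
  ↔-remove {n} {P} {R} (x ∷ xs) (x∉xs ∷ xs-unique) (px ∷ pxs) R⇔ P↔ =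
    subst (λ m → Fin m ↔ Σ A (T ∘ R)) (∸-+-assoc n 1 (length xs))
      (↔-remove xs xs-unique (All.zipWith P-∖x (pxs , x∉xs)) R⇔′ (↔-remove-one px P↔))
    where
    P-∖x : ∀ {y} → T (P y) × x ≢ y → T (P y ∧ not ⌊ y ≟ᴬ x ⌋)
    P-∖x {y} (py , x≢y) = ∧-intro py (fromWitnessFalse {a? = y ≟ᴬ x} (x≢y ∘ sym))
    R⇔′ : ∀ a → T (R a) ⇔ (T (P a ∧ not ⌊ a ≟ᴬ x ⌋) × All (a ≢_) xs)
    R⇔′ a = mk⇔ (shift ∘ Equivalence.to (R⇔ a)) (Equivalence.from (R⇔ a) ∘ unshift)
      where
      shift : T (P a) × All (a ≢_) (x ∷ xs) → T (P a ∧ not ⌊ a ≟ᴬ x ⌋) × All (a ≢_) xs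
      shift (pa , a≢x ∷ a∉xs) = ∧-intro pa (fromWitnessFalse {a? = a ≟ᴬ x} a≢x) , a∉xs
      unshift : T (P a ∧ not ⌊ a ≟ᴬ x ⌋) × All (a ≢_) xs → T (P a) × All (a ≢_) (x ∷ xs)
      unshift (p , a∉xs) = let (pa , a≢x) = ∧-elim {P a} p in pa , toWitnessFalse a≢x ∷ a∉xs

-- Cycles as vertex lists

module _ {n : ℕ} where

  ¬any⇔All≢ : ∀ (x : Fin n) xs → T (not (any (x ==_) xs)) ⇔ All (x ≢_) xs
  ¬any⇔All≢ x xs = mk⇔ (forth xs) (back xs)
    where
    forth : ∀ xs → T (not (any (x ==_) xs)) → All (x ≢_) xs
    forth []       _ = []
    forth (y ∷ ys) p with x ≟ y
    ... | no x≢y = x≢y ∷ forth ys p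
    back : ∀ xs → All (x ≢_) xs → T (not (any (x ==_) xs))
    back []       []           = tt
    back (y ∷ ys) (x≢y ∷ x∉ys) with x ≟ y
    ... | yes x≡y = x≢y x≡y
    ... | no _    = back ys x∉ys

  distinct⇔Unique : (xs : List (Fin n)) → T (distinct xs) ⇔ Unique xs
  distinct⇔Unique []       = mk⇔ (λ _ → []) (λ _ → tt)
  distinct⇔Unique (x ∷ xs) = mk⇔
    (λ p → let (x∉xs , d) = ∧-elim {not (any (x ==_) xs)} p
           in Equivalence.to (¬any⇔All≢ x xs) x∉xs ∷ Equivalence.to (distinct⇔Unique xs) d)
    (λ { (x∉xs ∷ u) → ∧-intro (Equivalence.from (¬any⇔All≢ x xs) x∉xs) (Equivalence.from (distinct⇔Unique xs) u) })

  module _ (a : Fin n → Fin n → Bool) where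

    pathAdj⇔Linked : ∀ xs → T (pathAdj a xs) ⇔ Linked (λ u v → T (a u v)) xs
    pathAdj⇔Linked xs = mk⇔ (forth xs) (back xs)
      where
      forth : ∀ xs → T (pathAdj a xs) → Linked (λ u v → T (a u v)) xs
      forth []           _ = []
      forth (x ∷ [])     _ = [-]
      forth (x ∷ y ∷ xs) p = let (axy , path) = ∧-elim {a x y} p in axy ∷ forth (y ∷ xs) path
      back : ∀ xs → Linked (λ u v → T (a u v)) xs → T (pathAdj a xs)
      back []           _            = tt
      back (x ∷ [])     _            = tt
      back (x ∷ y ∷ xs) (axy ∷ path) = ∧-intro axy (back (y ∷ xs) path)

    IsCycle : List (Fin n) → Set
    IsCycle []       = ⊥
    IsCycle (x ∷ xs) = Unique (x ∷ xs) × Linked (λ u v → T (a u v)) (x ∷ xs) × T (a (lastOr x xs) x)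

    isCycleL⇔IsCycle : ∀ xs → T (isCycleL a xs) ⇔ IsCycle xs
    isCycleL⇔IsCycle []       = mk⇔ (λ ()) (λ ())
    isCycleL⇔IsCycle (x ∷ xs) = mk⇔
      (λ p → let (d , rest) = ∧-elim {distinct (x ∷ xs)} p ; (path , closing) = ∧-elim {pathAdj a (x ∷ xs)} rest
             in Equivalence.to (distinct⇔Unique (x ∷ xs)) d , Equivalence.to (pathAdj⇔Linked (x ∷ xs)) path , closing)
      (λ (u , path , closing) → ∧-intro (Equivalence.from (distinct⇔Unique (x ∷ xs)) u)
                                       (∧-intro (Equivalence.from (pathAdj⇔Linked (x ∷ xs)) path) closing))

two-colouring : ∀ {a b c : Bool} → a ≢ b → b ≢ c → a ≡ c
two-colouring {false} {false} a≢b _   = ⊥-elim (a≢b refl)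
two-colouring {true}  {true}  a≢b _   = ⊥-elim (a≢b refl)
two-colouring {false} {true}  {false} _ _ = refl
two-colouring {true}  {false} {true}  _ _ = refl
two-colouring {false} {true}  {true}  _ b≢c = ⊥-elim (b≢c refl)
two-colouring {true}  {false} {false} _ b≢c = ⊥-elim (b≢c refl)

module _ {n} (G : Graph n) where

  private
    decode : ∀ {xs} → T (isCycleL (adj G) xs) → IsCycle (adj G) xs
    decode = Equivalence.to (isCycleL⇔IsCycle (adj G) _)

  bipartite⇒¬3-cycle : IsBipartite G → ¬ HasCycle G 3
  bipartite⇒¬3-cycle (col , proper) (_ , a ∷ b ∷ c ∷ [] , cyc) with decode {a ∷ b ∷ c ∷ []} cyc
  ... | _ , ab ∷ bc ∷ [-] , ca = proper c a ca (sym (two-colouring (proper a b ab) (proper b c bc)))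

  bipartite⇒¬5-cycle : IsBipartite G → ¬ HasCycle G 5
  bipartite⇒¬5-cycle (col , proper) (_ , a ∷ b ∷ c ∷ d ∷ e ∷ [] , cyc) with decode {a ∷ b ∷ c ∷ d ∷ e ∷ []} cyc
  ... | _ , ab ∷ bc ∷ cd ∷ de ∷ [-] , ea = proper e a ea (sym (trans
          (two-colouring (proper a b ab) (proper b c bc)) (two-colouring (proper c d cd) (proper d e de))))

-- Graphs on a finite vertex type

module FiniteGraph {V : Set} {N : ℕ} (V↔ : Fin N ↔ V) (E : V → V → Bool)
                   (E-sym : ∀ x y → E x y ≡ E y x) (E-irrefl : ∀ x → E x x ≡ false) where

  _~_ : V → V → Set
  x ~ y = T (E x y)

  graph : Graph N
  graph = record
    { adj    = λ u v → E (to V↔ u) (to V↔ v)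
    ; sym    = λ u v → E-sym (to V↔ u) (to V↔ v)
    ; irrefl = λ u → E-irrefl (to V↔ u)
    }

  walk⇒Reach : ∀ {x y} → Star _~_ x y → Reach graph (from V↔ x) (from V↔ y)
  walk⇒Reach ε = here
  walk⇒Reach {x} (_◅_ {j = y} x~y y↝z) =
    step (subst₂ _~_ (sym (strictlyInverseˡ V↔ x)) (sym (strictlyInverseˡ V↔ y)) x~y) (walk⇒Reach y↝z)

  connected : (∀ x y → Star _~_ x y) → IsConnected graph
  connected walk u v =
    subst₂ (Reach graph) (strictlyInverseʳ V↔ u) (strictlyInverseʳ V↔ v) (walk⇒Reach (walk (to V↔ u) (to V↔ v)))

  regular : ∀ {k} → (∀ x → Fin k ↔ Σ V (λ y → x ~ y)) → IsRegular graph k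
  regular nbrs v = ↔-trans (nbrs (to V↔ v)) (↔-sym (Σ-T-reindex V↔ (E (to V↔ v))))

  bipartite : (col : V → Bool) → (∀ x y → x ~ y → col x ≢ col y) → IsBipartite graph
  bipartite col proper = col ∘ to V↔ , λ u v → proper (to V↔ u) (to V↔ v)

  ¬4-cycle : (∀ {a b c d} → a ≢ c → a ~ b → b ~ c → c ~ d → d ~ a → b ≡ d) → ¬ HasCycle graph 4
  ¬4-cycle unique-common-nbr (_ , a ∷ b ∷ c ∷ d ∷ [] , cyc)
    with Equivalence.to (isCycleL⇔IsCycle (adj graph) (a ∷ b ∷ c ∷ d ∷ [])) cyc
  ... | (_ ∷ a≢c ∷ _ ∷ []) ∷ (_ ∷ b≢d ∷ []) ∷ _ , ab ∷ bc ∷ cd ∷ [-] , da =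
    b≢d (to-injective V↔ (unique-common-nbr (a≢c ∘ to-injective V↔) ab bc cd da))

  Hexagon : V → V → V × V × V × V → Set
  Hexagon a b (c , d , e , f) =
    Unique (a ∷ b ∷ c ∷ d ∷ e ∷ f ∷ []) × Linked _~_ (a ∷ b ∷ c ∷ d ∷ e ∷ f ∷ []) × f ~ a

  hexagon-reverse : ∀ {a b c d e f} → Hexagon a b (c , d , e , f) → Hexagon b a (f , e , d , c)
  hexagon-reverse
    ( ( (a≢b ∷ a≢c ∷ a≢d ∷ a≢e ∷ a≢f ∷ []) ∷ (b≢c ∷ b≢d ∷ b≢e ∷ b≢f ∷ [])
      ∷ (c≢d ∷ c≢e ∷ c≢f ∷ []) ∷ (d≢e ∷ d≢f ∷ []) ∷ (e≢f ∷ []) ∷ [] ∷ [])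
    , ab ∷ bc ∷ cd ∷ de ∷ ef ∷ [-] , fa) =
    ( ( (≢-sym a≢b ∷ b≢f ∷ b≢e ∷ b≢d ∷ b≢c ∷ []) ∷ (a≢f ∷ a≢e ∷ a≢d ∷ a≢c ∷ [])
      ∷ (≢-sym e≢f ∷ ≢-sym d≢f ∷ ≢-sym c≢f ∷ []) ∷ (≢-sym d≢e ∷ ≢-sym c≢e ∷ [])
      ∷ (≢-sym c≢d ∷ []) ∷ [] ∷ [])
    , ~-sym ab ∷ ~-sym fa ∷ ~-sym ef ∷ ~-sym de ∷ ~-sym cd ∷ [-] , ~-sym bc)
    where
    ~-sym : ∀ {x y} → x ~ y → y ~ x
    ~-sym {x} {y} = subst T (E-sym x y)

  module _ (_≟ᵛ_ : DecidableEquality V) where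

    hexagon? : ∀ a b w → Dec (Hexagon a b w)
    hexagon? a b (c , d , e , f) = unique? _ ×-dec linked? (λ x y → T? (E x y)) _ ×-dec T? (E f a)
      where open import Data.List.Relation.Unary.Unique.DecPropositional _≟ᵛ_ using (unique?)

    Hexagons : V → V → Set
    Hexagons a b = Σ (V × V × V × V) (λ w → True (hexagon? a b w))

    hexagon-evidence : ∀ a b w → Hexagon a b w → True (hexagon? a b w)
    hexagon-evidence a b w = fromWitness {a? = hexagon? a b w}

    hexagon-witness : ∀ a b w → True (hexagon? a b w) → Hexagon a b w
    hexagon-witness a b w = toWitness {a? = hexagon? a b w}

    Hexagons-reverse : ∀ a b → Hexagons a b ↔ Hexagons b a
    Hexagons-reverse a b = mk↔ₛ′ (rev a b) (rev b a) (λ _ → Σ-T-≡ refl) (λ _ → Σ-T-≡ refl)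
      where
      rev : ∀ a b → Hexagons a b → Hexagons b a
      rev a b ((c , d , e , f) , h) =
        (f , e , d , c) , hexagon-evidence b a _ (hexagon-reverse (hexagon-witness a b (c , d , e , f) h))

    Hexagons↔CyclesThrough : ∀ u v → Hexagons (to V↔ u) (to V↔ v) ↔ CyclesThrough graph 6 u v
    Hexagons↔CyclesThrough u v =
      ↔-trans (↔-sym (Σ-cong {k = bijection} (V↔ ×-↔ V↔ ×-↔ V↔ ×-↔ V↔) ↔-refl))
              (mk↔ₛ′ pack unpack pack∘unpack (λ _ → Σ-T-≡ refl))
      where
      Hexagon′ : Fin N × Fin N × Fin N × Fin N → Set
      Hexagon′ (c , d , e , f) = Hexagon (to V↔ u) (to V↔ v) (to V↔ c , to V↔ d , to V↔ e , to V↔ f)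
      encode : ∀ {c d e f} → Hexagon′ (c , d , e , f) → T (isCycleL (adj graph) (u ∷ v ∷ c ∷ d ∷ e ∷ f ∷ []))
      encode (uniq , path , closing) = Equivalence.from (isCycleL⇔IsCycle (adj graph) _)
        (AllPairs.map (λ ne → ne ∘ cong (to V↔)) (AllPairs.map⁻ uniq) , Linked.map⁻ path , closing)
      decode : ∀ u′ v′ c d e f → u′ ≡ u → v′ ≡ v →
               T (isCycleL (adj graph) (u′ ∷ v′ ∷ c ∷ d ∷ e ∷ f ∷ [])) → Hexagon′ (c , d , e , f)
      decode _ _ c d e f refl refl cyc with Equivalence.to (isCycleL⇔IsCycle (adj graph) _) cyc
      ... | uniq , path , closing = Unique.map⁺ (to-injective V↔) uniq , Linked.map⁺ path , closing
      Quads = Σ (Fin N × Fin N × Fin N × Fin N)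
                (λ (c , d , e , f) → True (hexagon? (to V↔ u) (to V↔ v) (to V↔ c , to V↔ d , to V↔ e , to V↔ f)))
      pack : Quads → CyclesThrough graph 6 u v
      pack ((c , d , e , f) , h) = (u ∷ v ∷ c ∷ d ∷ e ∷ f ∷ []) , ∧-intro starts (encode (hexagon-witness _ _ _ h))
        where
        starts : T ((u == u) ∧ (v == v))
        starts = ∧-intro {u == u} (fromWitness refl) (fromWitness refl)
      starts-with : ∀ u′ v′ xs → T (startsWith u v (u′ ∷ v′ ∷ xs) ∧ isCycleL (adj graph) (u′ ∷ v′ ∷ xs)) →
                    u′ ≡ u × v′ ≡ v
      starts-with u′ v′ xs p =
        let (u′≡u , v′≡v) = ∧-elim {u′ == u} (proj₁ (∧-elim p)) in toWitness u′≡u , toWitness v′≡v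
      unpack : CyclesThrough graph 6 u v → Quads
      unpack (u′ ∷ v′ ∷ c ∷ d ∷ e ∷ f ∷ [] , p) =
        (c , d , e , f) , fromWitness (decode u′ v′ c d e f (proj₁ starts) (proj₂ starts)
                                         (proj₂ (∧-elim {startsWith u v (u′ ∷ v′ ∷ c ∷ d ∷ e ∷ f ∷ [])} p)))
        where starts = starts-with u′ v′ (c ∷ d ∷ e ∷ f ∷ []) p
      pack∘unpack : ∀ z → pack (unpack z) ≡ z
      pack∘unpack (u′ ∷ v′ ∷ c ∷ d ∷ e ∷ f ∷ [] , p) =
        Σ-T-≡ (cong₂ (λ x y → x ∷ y ∷ c ∷ d ∷ e ∷ f ∷ []) (sym (proj₁ starts)) (sym (proj₂ starts)))
        where starts = starts-with u′ v′ (c ∷ d ∷ e ∷ f ∷ []) p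

-- Projective planes and the triangle

All-three⇔ : ∀ {A : Set} {P : A → Set} (f : Fin 3 → A) → All P (f 0F ∷ f 1F ∷ f 2F ∷ []) ⇔ (∀ k → P (f k))
All-three⇔ f = mk⇔ (λ { (p₀ ∷ _) 0F → p₀ ; (_ ∷ p₁ ∷ _) 1F → p₁ ; (_ ∷ _ ∷ p₂ ∷ _) 2F → p₂ })
                   (λ p → p 0F ∷ p 1F ∷ p 2F ∷ [])

Unique-three : ∀ {A : Set} (f : Fin 3 → A) → (∀ {i j} → i ≢ j → f i ≢ f j) → Unique (f 0F ∷ f 1F ∷ f 2F ∷ [])
Unique-three f f-inj = (f-inj (λ ()) ∷ f-inj (λ ()) ∷ []) ∷ (f-inj (λ ()) ∷ []) ∷ [] ∷ []

module PlaneGeometry {q : ℕ} (Π : ProjectivePlane q) where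

  open ProjectivePlane Π using (nPoints; nLines; inc; order; quad; quad-inj; quad-gen)

  Point Line : Set
  Point = Fin nPoints
  Line  = Fin nLines

  infix 4 _∈_ _∉_
  _∈_ _∉_ : Point → Line → Set
  x ∈ l = T (inc x l)
  x ∉ l = ¬ x ∈ l

  -- Total versions of the plane's line and meet; join x x and meet l l are junk values.
  join : Point → Point → Line
  join x y with x ≟ y
  ... | yes _   = ProjectivePlane.line Π (quad 0F) (quad 1F) (quad-inj 0F 1F λ ())
  ... | no x≢y = ProjectivePlane.line Π x y x≢y

  meet : Line → Line → Point
  meet l m with l ≟ m
  ... | yes _   = quad 0F
  ... | no l≢m = ProjectivePlane.meet Π l m l≢m

  module _ {x y : Point} (x≢y : x ≢ y) where

    join-∈ˡ : x ∈ join x y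
    join-∈ˡ with x ≟ y
    ... | yes x≡y = ⊥-elim (x≢y x≡y)
    ... | no x≢y′ = proj₁ (ProjectivePlane.line-inc Π x y x≢y′)

    join-∈ʳ : y ∈ join x y
    join-∈ʳ with x ≟ y
    ... | yes x≡y = ⊥-elim (x≢y x≡y)
    ... | no x≢y′ = proj₂ (ProjectivePlane.line-inc Π x y x≢y′)

    join-unique : ∀ {l} → x ∈ l → y ∈ l → l ≡ join x y
    join-unique {l} x∈l y∈l with x ≟ y
    ... | yes x≡y = ⊥-elim (x≢y x≡y)
    ... | no x≢y′ = ProjectivePlane.line-uniq Π x y x≢y′ l x∈l y∈l

  module _ {l m : Line} (l≢m : l ≢ m) where

    meet-∈ˡ : meet l m ∈ l
    meet-∈ˡ with l ≟ m
    ... | yes l≡m = ⊥-elim (l≢m l≡m)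
    ... | no l≢m′ = proj₁ (ProjectivePlane.meet-inc Π l m l≢m′)

    meet-∈ʳ : meet l m ∈ m
    meet-∈ʳ with l ≟ m
    ... | yes l≡m = ⊥-elim (l≢m l≡m)
    ... | no l≢m′ = proj₂ (ProjectivePlane.meet-inc Π l m l≢m′)

    meet-unique : ∀ {x} → x ∈ l → x ∈ m → x ≡ meet l m
    meet-unique {x} x∈l x∈m with l ≟ m
    ... | yes l≡m = ⊥-elim (l≢m l≡m)
    ... | no l≢m′ = ProjectivePlane.meet-uniq Π l m l≢m′ x x∈l x∈m

  unique-line : ∀ {x y l m} → x ≢ y → x ∈ l → y ∈ l → x ∈ m → y ∈ m → l ≡ m
  unique-line x≢y x∈l y∈l x∈m y∈m = trans (join-unique x≢y x∈l y∈l) (sym (join-unique x≢y x∈m y∈m))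

  unique-point : ∀ {l m x y} → l ≢ m → x ∈ l → x ∈ m → y ∈ l → y ∈ m → x ≡ y
  unique-point l≢m x∈l x∈m y∈l y∈m = trans (meet-unique l≢m x∈l x∈m) (sym (meet-unique l≢m y∈l y∈m))

  ≢-line : ∀ {x l m} → x ∈ l → x ∉ m → l ≢ m
  ≢-line x∈l x∉m refl = x∉m x∈l

  ≢-point : ∀ {x y l} → x ∈ l → y ∉ l → x ≢ y
  ≢-point x∈l y∉l refl = y∉l x∈l

  pointsOn : ∀ l → Fin (suc q) ↔ Σ Point (_∈ l)
  pointsOn = order

  linesThrough-↔-pointsOn : ∀ {x l} → x ∉ l → Σ Line (x ∈_) ↔ Σ Point (_∈ l)
  linesThrough-↔-pointsOn {x} {l} x∉l = mk↔ₛ′ project lift project∘lift lift∘project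
    where
    project : Σ Line (x ∈_) → Σ Point (_∈ l)
    project (m , x∈m) = meet m l , meet-∈ʳ (≢-line x∈m x∉l)
    lift : Σ Point (_∈ l) → Σ Line (x ∈_)
    lift (y , y∈l) = join x y , join-∈ˡ (≢-point y∈l x∉l ∘ sym)
    project∘lift : ∀ z → project (lift z) ≡ z
    project∘lift (y , y∈l) = Σ-T-≡ (sym (meet-unique (≢-line (join-∈ˡ x≢y) x∉l) (join-∈ʳ x≢y) y∈l))
      where x≢y = ≢-point y∈l x∉l ∘ sym
    lift∘project : ∀ z → lift (project z) ≡ z
    lift∘project (m , x∈m) = Σ-T-≡ (sym (join-unique x≢y x∈m (meet-∈ˡ m≢l)))
      where m≢l = ≢-line x∈m x∉l
            x≢y = ≢-point (meet-∈ʳ m≢l) x∉l ∘ sym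

  vertex : Fin 3 → Point
  vertex = quad ∘ inject₁

  vertex-injective : ∀ {i j} → i ≢ j → vertex i ≢ vertex j
  vertex-injective i≢j = quad-inj _ _ (i≢j ∘ inject₁-injective)

  noncollinear : ∀ {i j k l} → i ≢ j → i ≢ k → j ≢ k → vertex i ∈ l → vertex j ∈ l → vertex k ∉ l
  noncollinear i≢j i≢k j≢k i∈l j∈l k∈l =
    quad-gen _ _ _ (i≢j ∘ inject₁-injective) (i≢k ∘ inject₁-injective) (j≢k ∘ inject₁-injective) _ (i∈l , j∈l , k∈l)

  next prev : Fin 3 → Fin 3
  next 0F = 1F
  next 1F = 2F
  next 2F = 0F
  prev 0F = 2F
  prev 1F = 0F
  prev 2F = 1F

  next≢ : ∀ k → next k ≢ k
  next≢ 0F ()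
  next≢ 1F ()
  next≢ 2F ()

  prev≢ : ∀ k → prev k ≢ k
  prev≢ 0F ()
  prev≢ 1F ()
  prev≢ 2F ()

  next≢prev : ∀ k → next k ≢ prev k
  next≢prev 0F ()
  next≢prev 1F ()
  next≢prev 2F ()

  self-next-or-prev : ∀ k j → j ≡ k ⊎ j ≡ next k ⊎ j ≡ prev k
  self-next-or-prev 0F 0F = inj₁ refl
  self-next-or-prev 0F 1F = inj₂ (inj₁ refl)
  self-next-or-prev 0F 2F = inj₂ (inj₂ refl)
  self-next-or-prev 1F 0F = inj₂ (inj₂ refl)
  self-next-or-prev 1F 1F = inj₁ refl
  self-next-or-prev 1F 2F = inj₂ (inj₁ refl)
  self-next-or-prev 2F 0F = inj₂ (inj₁ refl)
  self-next-or-prev 2F 1F = inj₂ (inj₂ refl)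
  self-next-or-prev 2F 2F = inj₁ refl

  third : Fin 3 → Fin 3 → Fin 3
  third i j with self-next-or-prev i j
  ... | inj₂ (inj₁ _) = prev i
  ... | _             = next i

  third≢ˡ : ∀ i j → third i j ≢ i
  third≢ˡ i j with self-next-or-prev i j
  ... | inj₁ _        = next≢ i
  ... | inj₂ (inj₁ _) = prev≢ i
  ... | inj₂ (inj₂ _) = next≢ i

  third≢ʳ : ∀ {i j} → i ≢ j → third i j ≢ j
  third≢ʳ {i} {j} i≢j with self-next-or-prev i j
  ... | inj₁ j≡i          = ⊥-elim (i≢j (sym j≡i))
  ... | inj₂ (inj₁ refl) = next≢prev i ∘ sym
  ... | inj₂ (inj₂ refl) = next≢prev i

  side : Fin 3 → Line
  side k = join (vertex (next k)) (vertex (prev k))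

  vertex-∈-side : ∀ {i k} → i ≢ k → vertex i ∈ side k
  vertex-∈-side {i} {k} i≢k with self-next-or-prev k i
  ... | inj₁ i≡k          = ⊥-elim (i≢k i≡k)
  ... | inj₂ (inj₁ refl) = join-∈ˡ (vertex-injective (next≢prev k))
  ... | inj₂ (inj₂ refl) = join-∈ʳ (vertex-injective (next≢prev k))

  vertex-∉-side : ∀ k → vertex k ∉ side k
  vertex-∉-side k k∈side = noncollinear (next≢ k ∘ sym) (prev≢ k ∘ sym) (next≢prev k)
    k∈side (vertex-∈-side (next≢ k)) (vertex-∈-side (prev≢ k))

  side-injective : ∀ {i j} → i ≢ j → side i ≢ side j
  side-injective {i} i≢j = ≢-line (vertex-∈-side i≢j) (vertex-∉-side i) ∘ sym

  two-vertices⇒side : ∀ {i j l} → i ≢ j → vertex i ∈ l → vertex j ∈ l → l ≡ side (third i j)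
  two-vertices⇒side {i} {j} i≢j i∈l j∈l = unique-line (vertex-injective i≢j) i∈l j∈l
    (vertex-∈-side (third≢ˡ i j ∘ sym)) (vertex-∈-side (third≢ʳ i≢j ∘ sym))

  two-sides⇒vertex : ∀ {i j x} → i ≢ j → x ∈ side i → x ∈ side j → x ≡ vertex (third i j)
  two-sides⇒vertex {i} {j} i≢j x∈i x∈j = unique-point (side-injective i≢j) x∈i x∈j
    (vertex-∈-side (third≢ˡ i j)) (vertex-∈-side (third≢ʳ i≢j))

  missing-line : ∀ x → Σ Line (x ∉_)
  missing-line x with T? (inc x (side 0F)) | T? (inc x (side 1F))
  ... | no x∉s₀ | _      = side 0F , x∉s₀
  ... | yes _   | no x∉s₁ = side 1F , x∉s₁
  ... | yes x∈s₀ | yes x∈s₁ = side 2F , λ x∈s₂ →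
    vertex-∉-side 2F (subst (_∈ side 2F) (two-sides⇒vertex {0F} {1F} (λ ()) x∈s₀ x∈s₁) x∈s₂)

  linesThrough : ∀ x → Fin (suc q) ↔ Σ Line (x ∈_)
  linesThrough x = ↔-trans (pointsOn l) (↔-sym (linesThrough-↔-pointsOn x∉l))
    where
    l = proj₁ (missing-line x)
    x∉l = proj₂ (missing-line x)

-- The complement of the triangle

module TriangleComplement {q : ℕ} (Π : ProjectivePlane q) where

  open PlaneGeometry Π
  open ProjectivePlane Π using (inc)

  OffSides : Point → Set
  OffSides x = ∀ k → x ∉ side k

  MissesVertices : Line → Set
  MissesVertices l = ∀ k → vertex k ∉ l

  offSides? : Point → Bool
  offSides? x = ⌊ all? (λ k → ¬? (T? (inc x (side k)))) ⌋

  missesVertices? : Line → Bool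
  missesVertices? l = ⌊ all? (λ k → ¬? (T? (inc (vertex k) l))) ⌋

  offSides⇒≢vertex : ∀ {x} → OffSides x → ∀ k → x ≢ vertex k
  offSides⇒≢vertex off k refl = off (next k) (vertex-∈-side (next≢ k ∘ sym))

  missesVertices⇒≢side : ∀ {l} → MissesVertices l → ∀ k → l ≢ side k
  missesVertices⇒≢side miss k refl = miss (next k) (vertex-∈-side (next≢ k))

  two-vertices⇒¬OffSides : ∀ {i j l x} → i ≢ j → vertex i ∈ l → vertex j ∈ l → x ∈ l → ¬ OffSides x
  two-vertices⇒¬OffSides {i} {j} i≢j i∈l j∈l x∈l off =
    off (third i j) (subst (_ ∈_) (two-vertices⇒side i≢j i∈l j∈l) x∈l)

  module _ {x : Point} (off : OffSides x) where

    joinVertex : Fin 3 → Line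
    joinVertex k = join x (vertex k)

    x∈joinVertex : ∀ k → x ∈ joinVertex k
    x∈joinVertex k = join-∈ˡ (offSides⇒≢vertex off k)

    vertex∈joinVertex : ∀ k → vertex k ∈ joinVertex k
    vertex∈joinVertex k = join-∈ʳ (offSides⇒≢vertex off k)

    joinVertex-only : ∀ {i j} → i ≢ j → vertex j ∉ joinVertex i
    joinVertex-only {i} i≢j j∈ = two-vertices⇒¬OffSides i≢j (vertex∈joinVertex i) j∈ (x∈joinVertex i) off

    joinVertex-injective : ∀ {i j} → i ≢ j → joinVertex i ≢ joinVertex j
    joinVertex-injective {i} {j} i≢j e = joinVertex-only i≢j (subst (vertex j ∈_) (sym e) (vertex∈joinVertex j))

    joinVertex-unique : ∀ {k l} → x ∈ l → vertex k ∈ l → l ≡ joinVertex k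
    joinVertex-unique {k} = join-unique (offSides⇒≢vertex off k)

    missesVertices-linesThrough : Fin (q ∸ 2) ↔ Σ Line (λ l → T (missesVertices? l ∧ inc x l))
    missesVertices-linesThrough =
      ↔-remove _≟_ (joinVertex 0F ∷ joinVertex 1F ∷ joinVertex 2F ∷ []) (Unique-three joinVertex joinVertex-injective)
        (x∈joinVertex 0F ∷ x∈joinVertex 1F ∷ x∈joinVertex 2F ∷ []) R⇔ (linesThrough x)
      where
      R⇔ : ∀ l → T (missesVertices? l ∧ inc x l) ⇔
                 (x ∈ l × All (l ≢_) (joinVertex 0F ∷ joinVertex 1F ∷ joinVertex 2F ∷ []))
      R⇔ l = mk⇔
        (λ p → let (miss , x∈l) = ∧-elim {missesVertices? l} p
               in x∈l , Equivalence.from (All-three⇔ joinVertex)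
                          λ k e → toWitness miss k (subst (_ ∈_) (sym e) (vertex∈joinVertex k)))
        (λ (x∈l , ≢joins) → ∧-intro (fromWitness λ k k∈l →
           Equivalence.to (All-three⇔ joinVertex) ≢joins k (joinVertex-unique x∈l k∈l)) x∈l)

  module _ {l : Line} (miss : MissesVertices l) where

    meetSide : Fin 3 → Point
    meetSide k = meet l (side k)

    meetSide∈l : ∀ k → meetSide k ∈ l
    meetSide∈l k = meet-∈ˡ (missesVertices⇒≢side miss k)

    meetSide∈side : ∀ k → meetSide k ∈ side k
    meetSide∈side k = meet-∈ʳ (missesVertices⇒≢side miss k)

    meetSide-unique : ∀ {k x} → x ∈ l → x ∈ side k → x ≡ meetSide k
    meetSide-unique {k} = meet-unique (missesVertices⇒≢side miss k)

    meetSide-injective : ∀ {i j} → i ≢ j → meetSide i ≢ meetSide j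
    meetSide-injective {i} {j} i≢j e = miss (third i j) (subst (_∈ l) on-both (meetSide∈l i))
      where on-both = two-sides⇒vertex i≢j (meetSide∈side i) (subst (_∈ side j) (sym e) (meetSide∈side j))

    offSides-pointsOn : Fin (q ∸ 2) ↔ Σ Point (λ x → T (offSides? x ∧ inc x l))
    offSides-pointsOn =
      ↔-remove _≟_ (meetSide 0F ∷ meetSide 1F ∷ meetSide 2F ∷ []) (Unique-three meetSide meetSide-injective)
        (meetSide∈l 0F ∷ meetSide∈l 1F ∷ meetSide∈l 2F ∷ []) R⇔ (pointsOn l)
      where
      R⇔ : ∀ x → T (offSides? x ∧ inc x l) ⇔ (x ∈ l × All (x ≢_) (meetSide 0F ∷ meetSide 1F ∷ meetSide 2F ∷ []))
      R⇔ x = mk⇔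
        (λ p → let (off , x∈l) = ∧-elim {offSides? x} p
               in x∈l , Equivalence.from (All-three⇔ meetSide)
                          λ k e → toWitness off k (subst (_∈ side k) (sym e) (meetSide∈side k)))
        (λ (x∈l , ≢meets) → ∧-intro (fromWitness λ k x∈k →
           Equivalence.to (All-three⇔ meetSide) ≢meets k (meetSide-unique x∈l x∈k)) x∈l)

  OnlyVertex : Fin 3 → Line → Set
  OnlyVertex k l = vertex k ∈ l × (∀ j → j ≢ k → vertex j ∉ l)

  offSides-pointsOn-onlyVertex : ∀ {k l} → OnlyVertex k l → Fin (q ∸ 1) ↔ Σ Point (λ x → T (offSides? x ∧ inc x l))
  offSides-pointsOn-onlyVertex {k} {l} (k∈l , only) =
    ↔-remove _≟_ (vertex k ∷ meet l (side k) ∷ []) ((vk≢m ∷ []) ∷ [] ∷ []) (k∈l ∷ meet-∈ˡ l≢side ∷ [])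
      R⇔ (pointsOn l)
    where
    l≢side = ≢-line k∈l (vertex-∉-side k)
    vk≢m : vertex k ≢ meet l (side k)
    vk≢m e = vertex-∉-side k (subst (_∈ side k) (sym e) (meet-∈ʳ l≢side))
    off-if-≢ : ∀ {x} → x ∈ l → x ≢ vertex k → x ≢ meet l (side k) → OffSides x
    off-if-≢ {x} x∈l x≢vk x≢m j x∈j with j ≟ k
    ... | yes refl = x≢m (meet-unique l≢side x∈l x∈j)
    ... | no j≢k = only (third j k) (third≢ʳ j≢k) (subst (vertex (third j k) ∈_) (sym l≡side) (vertex-∈-side (third≢ˡ j k)))
      where l≡side = unique-line x≢vk x∈l k∈l x∈j (vertex-∈-side (j≢k ∘ sym))
    R⇔ : ∀ x → T (offSides? x ∧ inc x l) ⇔ (x ∈ l × All (x ≢_) (vertex k ∷ meet l (side k) ∷ []))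
    R⇔ x = mk⇔
      (λ p → let (off , x∈l) = ∧-elim {offSides? x} p
             in x∈l , offSides⇒≢vertex (toWitness off) k
                    ∷ (λ e → toWitness off k (subst (_∈ side k) (sym e) (meet-∈ʳ l≢side))) ∷ [])
      (λ { (x∈l , x≢vk ∷ x≢m ∷ []) → ∧-intro (fromWitness (off-if-≢ x∈l x≢vk x≢m)) x∈l })

  vertexOn : ∀ {l} → ¬ MissesVertices l → Σ (Fin 3) (λ k → vertex k ∈ l)
  vertexOn {l} hits with any? (λ k → T? (inc (vertex k) l))
  ... | yes found = found
  ... | no none   = ⊥-elim (hits λ k k∈l → none (k , k∈l))

  Point⁻ Line⁻ : Set
  Point⁻ = Σ Point (T ∘ offSides?)
  Line⁻  = Σ Line (T ∘ missesVertices?)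

  -- Point⁻ and Line⁻ are counted by projecting from A onto the q − 1 non-vertex points of the
  -- opposite side.
  A : Point
  A = vertex 0F

  onOppositeSide? : Point → Bool
  onOppositeSide? y = inc y (side 0F) ∧ ⌊ all? (λ k → ¬? (y ≟ vertex k)) ⌋

  OppositeSide : Set
  OppositeSide = Σ Point (T ∘ onOppositeSide?)

  OppositeSide-size : Fin (q ∸ 1) ↔ OppositeSide
  OppositeSide-size = ↔-remove _≟_ (vertex 1F ∷ vertex 2F ∷ []) ((vertex-injective (λ ()) ∷ []) ∷ [] ∷ [])
    (vertex-∈-side {k = 0F} (λ ()) ∷ vertex-∈-side {k = 0F} (λ ()) ∷ []) R⇔ (pointsOn (side 0F))
    where
    R⇔ : ∀ y → T (onOppositeSide? y) ⇔ (y ∈ side 0F × All (y ≢_) (vertex 1F ∷ vertex 2F ∷ []))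
    R⇔ y = mk⇔
      (λ p → let (y∈s , ≢v) = ∧-elim {inc y (side 0F)} p in y∈s , toWitness ≢v 1F ∷ toWitness ≢v 2F ∷ [])
      (λ { (y∈s , y≢v₁ ∷ y≢v₂ ∷ []) → ∧-intro y∈s (fromWitness λ
           { 0F refl → vertex-∉-side 0F y∈s ; 1F → y≢v₁ ; 2F → y≢v₂ }) })

  module _ {y : Point} (p : T (onOppositeSide? y)) where

    opposite∈side : y ∈ side 0F
    opposite∈side = proj₁ (∧-elim {inc y (side 0F)} p)

    opposite≢vertex : ∀ k → y ≢ vertex k
    opposite≢vertex = toWitness (proj₂ (∧-elim {inc y (side 0F)} p))

    A≢opposite : A ≢ y
    A≢opposite = opposite≢vertex 0F ∘ sym

    join-A-onlyVertex : OnlyVertex 0F (join A y)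
    join-A-onlyVertex = join-∈ˡ A≢opposite , λ j j≢0 j∈ → opposite≢vertex j
      (unique-point (≢-line (join-∈ˡ A≢opposite) (vertex-∉-side 0F)) (join-∈ʳ A≢opposite) opposite∈side
                    j∈ (vertex-∈-side j≢0))

    missesVertices-linesThrough-opposite : Fin (q ∸ 1) ↔ Σ Line (λ l → T (missesVertices? l ∧ inc y l))
    missesVertices-linesThrough-opposite =
      ↔-remove _≟_ (side 0F ∷ join y A ∷ []) ((side≢join ∷ []) ∷ [] ∷ []) (opposite∈side ∷ join-∈ˡ y≢A ∷ [])
        R⇔ (linesThrough y)
      where
      y≢A = A≢opposite ∘ sym
      side≢join : side 0F ≢ join y A
      side≢join = ≢-line (join-∈ʳ y≢A) (vertex-∉-side 0F) ∘ sym
      misses : ∀ {l} → y ∈ l → l ≢ side 0F → l ≢ join y A → MissesVertices l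
      misses y∈l l≢s l≢j 0F A∈l = l≢j (join-unique y≢A y∈l A∈l)
      misses y∈l l≢s l≢j 1F v∈l =
        l≢s (unique-line (opposite≢vertex 1F) y∈l v∈l opposite∈side (vertex-∈-side {k = 0F} (λ ())))
      misses y∈l l≢s l≢j 2F v∈l =
        l≢s (unique-line (opposite≢vertex 2F) y∈l v∈l opposite∈side (vertex-∈-side {k = 0F} (λ ())))
      R⇔ : ∀ l → T (missesVertices? l ∧ inc y l) ⇔ (y ∈ l × All (l ≢_) (side 0F ∷ join y A ∷ []))
      R⇔ l = mk⇔
        (λ r → let (miss , y∈l) = ∧-elim {missesVertices? l} r
               in y∈l , missesVertices⇒≢side (toWitness miss) 0F
                      ∷ (λ e → toWitness miss 0F (subst (A ∈_) (sym e) (join-∈ʳ y≢A))) ∷ [])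
        (λ { (y∈l , l≢s ∷ l≢j ∷ []) → ∧-intro (fromWitness (misses y∈l l≢s l≢j)) y∈l })

  Point⁻-size : Fin ((q ∸ 1) * (q ∸ 1)) ↔ Point⁻
  Point⁻-size = ↔-trans (Σ-size OppositeSide-size (λ (_ , p) → offSides-pointsOn-onlyVertex (join-A-onlyVertex p)))
                        (↔-sym (Σ-T-fibres foot in-fibre fibre-foot))
    where
    module _ {x : Point} (off : OffSides x) where
      A≢x : A ≢ x
      A≢x = offSides⇒≢vertex off 0F ∘ sym
      Ax≢side : join A x ≢ side 0F
      Ax≢side = ≢-line (join-∈ˡ A≢x) (vertex-∉-side 0F)
      foot-≢vertex : ∀ k → meet (join A x) (side 0F) ≢ vertex k
      foot-≢vertex 0F e = vertex-∉-side 0F (subst (_∈ side 0F) e (meet-∈ʳ Ax≢side))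
      foot-≢vertex (suc k) e =
        two-vertices⇒¬OffSides {0F} (λ ()) (join-∈ˡ A≢x) (subst (_∈ join A x) e (meet-∈ˡ Ax≢side)) (join-∈ʳ A≢x) off
    foot : ∀ x → T (offSides? x) → OppositeSide
    foot x off = meet (join A x) (side 0F) ,
      ∧-intro (meet-∈ʳ (Ax≢side (toWitness off))) (fromWitness (foot-≢vertex (toWitness off)))
    in-fibre : ∀ x off → T (offSides? x ∧ inc x (join A (proj₁ (foot x off))))
    in-fibre x off = ∧-intro off (subst (x ∈_) Ax≡Ay (join-∈ʳ (A≢x off′)))
      where
      off′ = toWitness off
      Ax≡Ay = join-unique (A≢opposite (proj₂ (foot x off))) (join-∈ˡ (A≢x off′)) (meet-∈ˡ (Ax≢side off′))
    fibre-foot : ∀ y x → T (offSides? x ∧ inc x (join A (proj₁ y))) → Σ (T (offSides? x)) (λ off → foot x off ≡ y)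
    fibre-foot (y , p) x r =
      off , Σ-T-≡ (sym (meet-unique (Ax≢side off′) (subst (y ∈_) Ay≡Ax (join-∈ʳ (A≢opposite p))) (opposite∈side p)))
      where
      off = proj₁ (∧-elim {offSides? x} r)
      off′ = toWitness off
      Ay≡Ax = join-unique (A≢x off′) (join-∈ˡ (A≢opposite p)) (proj₂ (∧-elim {offSides? x} r))

  Line⁻-size : Fin ((q ∸ 1) * (q ∸ 1)) ↔ Line⁻
  Line⁻-size = ↔-trans (Σ-size OppositeSide-size (λ (_ , p) → missesVertices-linesThrough-opposite p))
                       (↔-sym (Σ-T-fibres foot in-fibre fibre-foot))
    where
    foot-≢vertex : ∀ {l} → MissesVertices l → ∀ k → meet l (side 0F) ≢ vertex k
    foot-≢vertex miss 0F e = vertex-∉-side 0F (subst (_∈ side 0F) e (meetSide∈side miss 0F))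
    foot-≢vertex miss k e = miss k (subst (_∈ _) e (meetSide∈l miss 0F))
    foot : ∀ l → T (missesVertices? l) → OppositeSide
    foot l miss = meetSide (toWitness miss) 0F ,
                  ∧-intro (meetSide∈side (toWitness miss) 0F) (fromWitness (foot-≢vertex (toWitness miss)))
    in-fibre : ∀ l miss → T (missesVertices? l ∧ inc (proj₁ (foot l miss)) l)
    in-fibre l miss = ∧-intro miss (meetSide∈l (toWitness miss) 0F)
    fibre-foot : ∀ y l → T (missesVertices? l ∧ inc (proj₁ y) l) → Σ (T (missesVertices? l)) (λ miss → foot l miss ≡ y)
    fibre-foot (y , p) l r = miss , Σ-T-≡ (sym (meetSide-unique (toWitness miss) {0F} y∈l (opposite∈side p)))
      where
      miss = proj₁ (∧-elim {missesVertices? l} r)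
      y∈l = proj₂ (∧-elim {missesVertices? l} r)

-- The incidence graph

module IncidenceGraph {q : ℕ} (Π : ProjectivePlane q) where

  open PlaneGeometry Π
  open TriangleComplement Π
  open ProjectivePlane Π using (inc)

  Vertex : Set
  Vertex = Point⁻ ⊎ Line⁻

  incident? : Vertex → Vertex → Bool
  incident? (inj₁ (x , _)) (inj₂ (l , _)) = inc x l
  incident? (inj₂ (l , _)) (inj₁ (x , _)) = inc x l
  incident? _              _              = false

  incident?-sym : ∀ u v → incident? u v ≡ incident? v u
  incident?-sym (inj₁ _) (inj₁ _) = refl
  incident?-sym (inj₁ _) (inj₂ _) = refl
  incident?-sym (inj₂ _) (inj₁ _) = refl
  incident?-sym (inj₂ _) (inj₂ _) = refl

  incident?-irrefl : ∀ u → incident? u u ≡ false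
  incident?-irrefl (inj₁ _) = refl
  incident?-irrefl (inj₂ _) = refl

  Vertex-size : Fin (2 * ((q ∸ 1) * (q ∸ 1))) ↔ Vertex
  Vertex-size = subst (λ m → Fin ((q ∸ 1) * (q ∸ 1) + m) ↔ Vertex) (sym (+-identityʳ _))
                      (↔-trans +↔⊎ (Point⁻-size ⊎-↔ Line⁻-size))

  _≟ᵛ_ : DecidableEquality Vertex
  _≟ᵛ_ = Sum.≡-dec (Σ-T-≟ _≟_) (Σ-T-≟ _≟_)

  open FiniteGraph Vertex-size incident? incident?-sym incident?-irrefl public

  isPoint : Vertex → Bool
  isPoint (inj₁ _) = true
  isPoint (inj₂ _) = false

  isPoint-proper : ∀ u v → u ~ v → isPoint u ≢ isPoint v
  isPoint-proper (inj₁ _) (inj₂ _) _ ()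
  isPoint-proper (inj₂ _) (inj₁ _) _ ()

  neighbours-of-point : ∀ x → Σ Line⁻ (λ l → proj₁ x ∈ proj₁ l) ↔ Σ Vertex (inj₁ x ~_)
  neighbours-of-point x = mk↔ₛ′ (λ (l , x∈l) → inj₂ l , x∈l) (λ { (inj₂ l , x∈l) → l , x∈l ; (inj₁ _ , ()) })
    (λ { (inj₂ _ , _) → refl ; (inj₁ _ , ()) }) (λ (_ , _) → refl)

  neighbours-of-line : ∀ l → Σ Point⁻ (λ x → proj₁ x ∈ proj₁ l) ↔ Σ Vertex (inj₂ l ~_)
  neighbours-of-line l = mk↔ₛ′ (λ (x , x∈l) → inj₁ x , x∈l) (λ { (inj₁ x , x∈l) → x , x∈l ; (inj₂ _ , ()) })
    (λ { (inj₁ _ , _) → refl ; (inj₂ _ , ()) }) (λ (_ , _) → refl)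

  degree : ∀ u → Fin (q ∸ 2) ↔ Σ Vertex (u ~_)
  degree (inj₁ (x , off)) = ↔-trans (missesVertices-linesThrough (toWitness off))
    (↔-trans (↔-sym (Σ-T-assoc missesVertices? (inc x))) (neighbours-of-point (x , off)))
  degree (inj₂ (l , miss)) = ↔-trans (offSides-pointsOn (toWitness miss))
    (↔-trans (↔-sym (Σ-T-assoc offSides? (λ x → inc x l))) (neighbours-of-line (l , miss)))

  at-most-one-common-neighbour : ∀ {a b c d} → a ≢ c → a ~ b → b ~ c → c ~ d → d ~ a → b ≡ d
  at-most-one-common-neighbour {inj₁ x} {inj₂ l} {inj₁ y} {inj₂ m} a≢c x∈l y∈l y∈m x∈m =
    cong inj₂ (Σ-T-≡ (unique-line (a≢c ∘ cong inj₁ ∘ Σ-T-≡) x∈l y∈l x∈m y∈m))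
  at-most-one-common-neighbour {inj₂ l} {inj₁ x} {inj₂ m} {inj₁ y} a≢c x∈l x∈m y∈m y∈l =
    cong inj₁ (Σ-T-≡ (unique-point (a≢c ∘ cong inj₂ ∘ Σ-T-≡) x∈l x∈m y∈l y∈m))

  -- If the line PQ passes through the vertex Z, walk P → PR → R → QR → Q through a point R of
  -- ZX, where X = PY ∩ QW for the other vertices Y, W: the line ZX meets no other vertex, and PR
  -- and QR miss every vertex as soon as R avoids X, ZX ∩ QY and ZX ∩ PW.
  module Detour {P Q : Point} (P-off : OffSides P) (Q-off : OffSides Q) (P≢Q : P ≢ Q)
                {k : Fin 3} (k∈PQ : vertex k ∈ join P Q) where

    private
      P∈PQ = join-∈ˡ P≢Q
      Q∈PQ = join-∈ʳ P≢Q
      Z = vertex k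
      PY = joinVertex P-off (next k)
      PW = joinVertex P-off (prev k)
      QY = joinVertex Q-off (next k)
      QW = joinVertex Q-off (prev k)
      Z∉PY = joinVertex-only P-off (next≢ k)
      Z∉PW = joinVertex-only P-off (prev≢ k)
      Z∉QY = joinVertex-only Q-off (next≢ k)
      Z∉QW = joinVertex-only Q-off (prev≢ k)

      PY≢QW : PY ≢ QW
      PY≢QW e = two-vertices⇒¬OffSides (next≢prev k) (vertex∈joinVertex P-off (next k))
        (subst (vertex (prev k) ∈_) (sym e) (vertex∈joinVertex Q-off (prev k))) (x∈joinVertex P-off (next k)) P-off

      X = meet PY QW
      X∈PY = meet-∈ˡ PY≢QW
      X∈QW = meet-∈ʳ PY≢QW
      Z≢X = ≢-point X∈PY Z∉PY ∘ sym

    ZX : Line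
    ZX = join Z X

    private
      Z∈ZX = join-∈ˡ Z≢X
      X∈ZX = join-∈ʳ Z≢X

      P∉ZX : P ∉ ZX
      P∉ZX P∈ZX = Z∉QW (subst (Z ∈_) (sym QW≡PQ) k∈PQ)
        where
        ZX≡PQ = unique-line (offSides⇒≢vertex P-off k) P∈ZX Z∈ZX P∈PQ k∈PQ
        X≡P = unique-point (≢-line k∈PQ Z∉PY) (subst (X ∈_) ZX≡PQ X∈ZX) X∈PY P∈PQ (x∈joinVertex P-off (next k))
        QW≡PQ = unique-line P≢Q (subst (_∈ QW) X≡P X∈QW) (x∈joinVertex Q-off (prev k)) P∈PQ Q∈PQ

      Q∉ZX : Q ∉ ZX
      Q∉ZX Q∈ZX = P∉ZX (subst (P ∈_) (sym (unique-line (offSides⇒≢vertex Q-off k) Q∈ZX Z∈ZX Q∈PQ k∈PQ)) P∈PQ)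

    ZX-onlyVertex : OnlyVertex k ZX
    ZX-onlyVertex = Z∈ZX , only
      where
      only : ∀ j → j ≢ k → vertex j ∉ ZX
      only j j≢k j∈ZX with self-next-or-prev k j
      ... | inj₁ j≡k = j≢k j≡k
      ... | inj₂ (inj₁ refl) with X ≟ vertex j
      ...   | yes X≡Y = two-vertices⇒¬OffSides (next≢prev k) (subst (_∈ QW) X≡Y X∈QW)
                          (vertex∈joinVertex Q-off (prev k)) (x∈joinVertex Q-off (prev k)) Q-off
      ...   | no X≢Y  = Z∉PY (subst (Z ∈_) (unique-line X≢Y X∈ZX j∈ZX X∈PY (vertex∈joinVertex P-off j)) Z∈ZX)
      only j j≢k j∈ZX | inj₂ (inj₂ refl) with X ≟ vertex j
      ...   | yes X≡W = two-vertices⇒¬OffSides (next≢prev k) (vertex∈joinVertex P-off (next k))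
                          (subst (_∈ PY) X≡W X∈PY) (x∈joinVertex P-off (next k)) P-off
      ...   | no X≢W  = Z∉QW (subst (Z ∈_) (unique-line X≢W X∈ZX j∈ZX X∈QW (vertex∈joinVertex Q-off j)) Z∈ZX)

    Detour : Set
    Detour = Σ Point (λ R → OffSides R × P ≢ R × Q ≢ R × MissesVertices (join P R) × MissesVertices (join Q R))

    module _ {R} (R-off : OffSides R) (R∈ZX : R ∈ ZX) (R≢X : R ≢ X)
             (R≢QY : R ≢ meet ZX QY) (R≢PW : R ≢ meet ZX PW) where

      private
        P≢R = ≢-point R∈ZX P∉ZX ∘ sym
        Q≢R = ≢-point R∈ZX Q∉ZX ∘ sym
        R∉PQ : R ∉ join P Q
        R∉PQ R∈PQ = offSides⇒≢vertex R-off k (unique-point (≢-line P∈PQ P∉ZX) R∈PQ R∈ZX k∈PQ Z∈ZX)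

      detour-via : Detour
      detour-via = R , R-off , P≢R , Q≢R , PR-misses , QR-misses
        where
        PR-misses : MissesVertices (join P R)
        PR-misses j j∈PR with self-next-or-prev k j | joinVertex-unique P-off (join-∈ˡ P≢R) j∈PR
        ... | inj₁ refl        | _     =
          R∉PQ (subst (R ∈_) (unique-line (offSides⇒≢vertex P-off k) (join-∈ˡ P≢R) j∈PR P∈PQ k∈PQ) (join-∈ʳ P≢R))
        ... | inj₂ (inj₁ refl) | PR≡PY =
          R≢X (unique-point (≢-line Z∈ZX Z∉PY) R∈ZX (subst (R ∈_) PR≡PY (join-∈ʳ P≢R)) X∈ZX X∈PY)
        ... | inj₂ (inj₂ refl) | PR≡PW =
          R≢PW (meet-unique (≢-line Z∈ZX Z∉PW) R∈ZX (subst (R ∈_) PR≡PW (join-∈ʳ P≢R)))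
        QR-misses : MissesVertices (join Q R)
        QR-misses j j∈QR with self-next-or-prev k j | joinVertex-unique Q-off (join-∈ˡ Q≢R) j∈QR
        ... | inj₁ refl        | _     =
          R∉PQ (subst (R ∈_) (unique-line (offSides⇒≢vertex Q-off k) (join-∈ˡ Q≢R) j∈QR Q∈PQ k∈PQ) (join-∈ʳ Q≢R))
        ... | inj₂ (inj₁ refl) | QR≡QY =
          R≢QY (meet-unique (≢-line Z∈ZX Z∉QY) R∈ZX (subst (R ∈_) QR≡QY (join-∈ʳ Q≢R)))
        ... | inj₂ (inj₂ refl) | QR≡QW =
          R≢X (unique-point (≢-line Z∈ZX Z∉QW) R∈ZX (subst (R ∈_) QR≡QW (join-∈ʳ Q≢R)) X∈ZX X∈QW)

    detour : 3 < q ∸ 1 → Detour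
    detour 3<q-1 = detour-via (toWitness (proj₁ R-on)) (proj₂ R-on) (outside 0F) (outside 1F) (outside 2F)
      where
      avoided : Fin 3 → Point
      avoided 0F = X
      avoided 1F = meet ZX QY
      avoided 2F = meet ZX PW
      found = outside-family _≟_ 3<q-1 (offSides-pointsOn-onlyVertex ZX-onlyVertex) avoided
      R-on = ∧-elim {offSides? (proj₁ found)} (proj₁ (proj₂ found))
      outside = proj₂ (proj₂ found)

  walk-via-line : ∀ {x y : Point⁻} (l : Line⁻) → proj₁ x ∈ proj₁ l → proj₁ y ∈ proj₁ l →
                  Star _~_ (inj₁ x) (inj₁ y)
  walk-via-line l x∈l y∈l = _◅_ {j = inj₂ l} x∈l (y∈l ◅ ε)

  module _ (q>4 : 4 < q) where

    walk-via-detour : ∀ {P Q} (p : T (offSides? P)) (p′ : T (offSides? Q)) → P ≢ Q → ∀ {k} → vertex k ∈ join P Q →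
                      Star _~_ (inj₁ (P , p)) (inj₁ (Q , p′))
    walk-via-detour {P} {Q} p p′ P≢Q k∈PQ =
      walk-via-line {y = R , fromWitness R-off} (join P R , fromWitness PR-misses) (join-∈ˡ P≢R) (join-∈ʳ P≢R) ◅◅
      walk-via-line (join Q R , fromWitness QR-misses) (join-∈ʳ Q≢R) (join-∈ˡ Q≢R)
      where
      d = Detour.detour (toWitness p) (toWitness p′) P≢Q k∈PQ (∸-monoˡ-< q>4 (s≤s z≤n))
      R = proj₁ d
      R-off = proj₁ (proj₂ d)
      P≢R = proj₁ (proj₂ (proj₂ d))
      Q≢R = proj₁ (proj₂ (proj₂ (proj₂ d)))
      PR-misses = proj₁ (proj₂ (proj₂ (proj₂ (proj₂ d))))
      QR-misses = proj₂ (proj₂ (proj₂ (proj₂ (proj₂ d))))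

    point-walk : ∀ x y → Star _~_ (inj₁ x) (inj₁ y)
    point-walk (P , p) (Q , p′) with P ≟ Q
    ... | yes refl = subst (λ r → Star _~_ (inj₁ (P , p)) (inj₁ (P , r))) (T-irrelevant p p′) ε
    ... | no P≢Q with T? (missesVertices? (join P Q))
    ...   | yes miss = walk-via-line (join P Q , miss) (join-∈ˡ P≢Q) (join-∈ʳ P≢Q)
    ...   | no hits  = walk-via-detour p p′ P≢Q (proj₂ (vertexOn (hits ∘ fromWitness)))

    pointOn : (l : Line⁻) → Σ Point⁻ (λ x → proj₁ x ∈ proj₁ l)
    pointOn (l , miss) = to (↔-trans (offSides-pointsOn (toWitness miss)) (↔-sym (Σ-T-assoc offSides? (λ x → inc x l))))
                            (fromℕ< (m<n⇒0<n∸m (<-trans (s≤s (s≤s (s≤s z≤n))) q>4)))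

    walk-from-point : ∀ x v → Star _~_ (inj₁ x) v
    walk-from-point x (inj₁ y) = point-walk x y
    walk-from-point x (inj₂ l) = point-walk x (proj₁ (pointOn l)) ◅◅ _◅_ {j = inj₂ l} (proj₂ (pointOn l)) ε

    walk : ∀ u v → Star _~_ u v
    walk (inj₁ x) v = walk-from-point x v
    walk (inj₂ l) v =
      _◅_ {j = inj₁ (proj₁ (pointOn l))} (proj₂ (pointOn l)) (walk-from-point (proj₁ (pointOn l)) v)

  module HexagonCount {P : Point} {ℓ : Line} (p : T (offSides? P)) (pℓ : T (missesVertices? ℓ)) (P∈ℓ : P ∈ ℓ) where

    private
      P-off = toWitness p
      ℓ-miss = toWitness pℓ
      as-q∸3 : ∀ {X : Set} → Fin (q ∸ 2 ∸ 1) ↔ X → Fin (q ∸ 3) ↔ X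
      as-q∸3 {X} = subst (λ n → Fin n ↔ X) (∸-+-assoc q 2 1)

    otherPointOn? : Line → Point → Bool
    otherPointOn? m x = (offSides? x ∧ inc x m) ∧ not ⌊ x ≟ P ⌋

    otherLine? : Line → Bool
    otherLine? m = (missesVertices? m ∧ inc P m) ∧ not ⌊ m ≟ ℓ ⌋

    otherPointOn⇔ : ∀ {m x} → T (otherPointOn? m x) ⇔ (OffSides x × x ∈ m × x ≢ P)
    otherPointOn⇔ {m} {x} = mk⇔ forth back
      where
      forth : T (otherPointOn? m x) → OffSides x × x ∈ m × x ≢ P
      forth t = toWitness (proj₁ off∈) , proj₂ off∈ , toWitnessFalse (proj₂ t′)
        where t′ = ∧-elim {offSides? x ∧ inc x m} t
              off∈ = ∧-elim {offSides? x} (proj₁ t′)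
      back : OffSides x × x ∈ m × x ≢ P → T (otherPointOn? m x)
      back (off , x∈m , x≢P) = ∧-intro (∧-intro {offSides? x} (fromWitness off) x∈m) (fromWitnessFalse x≢P)

    otherLine⇔ : ∀ {m} → T (otherLine? m) ⇔ (MissesVertices m × P ∈ m × m ≢ ℓ)
    otherLine⇔ {m} = mk⇔ forth back
      where
      forth : T (otherLine? m) → MissesVertices m × P ∈ m × m ≢ ℓ
      forth o = toWitness (proj₁ miss∋) , proj₂ miss∋ , toWitnessFalse (proj₂ o′)
        where o′ = ∧-elim {missesVertices? m ∧ inc P m} o
              miss∋ = ∧-elim {missesVertices? m} (proj₁ o′)
      back : MissesVertices m × P ∈ m × m ≢ ℓ → T (otherLine? m)
      back (miss , P∈m , m≢ℓ) = ∧-intro (∧-intro {missesVertices? m} (fromWitness miss) P∈m) (fromWitnessFalse m≢ℓ)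

    SecondPoint OtherLine : Set
    SecondPoint = Σ Point (T ∘ otherPointOn? ℓ)
    OtherLine   = Σ Line (T ∘ otherLine?)

    Closing : Set
    Closing = Σ OtherLine (λ m → Σ Point (T ∘ otherPointOn? (proj₁ m)))

    SecondPoint-size : Fin (q ∸ 3) ↔ SecondPoint
    SecondPoint-size = as-q∸3 (↔-remove-one _≟_ (∧-intro p P∈ℓ) (offSides-pointsOn ℓ-miss))

    Closing-size : Fin ((q ∸ 3) * (q ∸ 3)) ↔ Closing
    Closing-size = Σ-size (as-q∸3 (↔-remove-one _≟_ (∧-intro pℓ P∈ℓ) (missesVertices-linesThrough P-off)))
      λ (m , o) → let (miss , P∈m , _) = Equivalence.to (otherLine⇔ {m}) o
                  in as-q∸3 (↔-remove-one _≟_ (∧-intro p P∈m) (offSides-pointsOn miss))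

    blocked? : Point → Closing → Bool
    blocked? P₂ (_ , P₃ , _) = not (missesVertices? (join P₂ P₃))

    module Blocked {P₂ : Point} (w : T (otherPointOn? ℓ P₂)) where

      private
        P₂-off = proj₁ (Equivalence.to (otherPointOn⇔ {ℓ} {P₂}) w)
        P₂∈ℓ = proj₁ (proj₂ (Equivalence.to (otherPointOn⇔ {ℓ} {P₂}) w))
        P₂≢P = proj₂ (proj₂ (Equivalence.to (otherPointOn⇔ {ℓ} {P₂}) w))
        P₂Z = joinVertex P₂-off
        PZ = joinVertex P-off

        P∉P₂Z : ∀ k → P ∉ P₂Z k
        P∉P₂Z k P∈P₂Z = ℓ-miss k (subst (vertex k ∈_) P₂Z≡ℓ (vertex∈joinVertex P₂-off k))
          where P₂Z≡ℓ = unique-line P₂≢P (x∈joinVertex P₂-off k) P∈P₂Z P₂∈ℓ P∈ℓ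

        P₂Z≢PZ : ∀ k j → P₂Z k ≢ PZ j
        P₂Z≢PZ k j = ≢-line (x∈joinVertex P-off j) (P∉P₂Z k) ∘ sym

        P₂Z≢side : ∀ k → P₂Z k ≢ side k
        P₂Z≢side k = ≢-line (vertex∈joinVertex P₂-off k) (vertex-∉-side k)

      P₂Z∩side : Fin 3 → Point
      P₂Z∩side k = meet (P₂Z k) (side k)

      P₂Z∩PZ : Fin 3 → Fin 3 → Point
      P₂Z∩PZ k j = meet (P₂Z k) (PZ j)

      -- A closing (m, X) is blocked at the vertex Z = vertex k iff X is a point of P₂Z other than
      -- these five: they are exactly the points for which X would lie on a side or m = PX would
      -- be ℓ or pass through a vertex.
      excluded : Fin 3 → List Point
      excluded k = vertex k ∷ P₂Z∩side k ∷ P₂ ∷ P₂Z∩PZ k (next k) ∷ P₂Z∩PZ k (prev k) ∷ []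

      blockingPoint? : Fin 3 → Point → Bool
      blockingPoint? k x = ⌊ T? (inc x (P₂Z k)) ×-dec All.all? (λ y → ¬? (x ≟ y)) (excluded k) ⌋

      private
        P₂Z∩PZ∈PZ : ∀ k j → P₂Z∩PZ k j ∈ PZ j
        P₂Z∩PZ∈PZ k j = meet-∈ʳ (P₂Z≢PZ k j)

        P₂Z∩side∈side : ∀ k → P₂Z∩side k ∈ side k
        P₂Z∩side∈side k = meet-∈ʳ (P₂Z≢side k)

        vertex≢P₂Z∩PZ : ∀ {k j} → j ≢ k → vertex k ≢ P₂Z∩PZ k j
        vertex≢P₂Z∩PZ {k} {j} j≢k e = joinVertex-only P-off j≢k (subst (_∈ PZ j) (sym e) (P₂Z∩PZ∈PZ k j))

        P₂Z∩side≢P₂Z∩PZ : ∀ {k j} → j ≢ k → P₂Z∩side k ≢ P₂Z∩PZ k j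
        P₂Z∩side≢P₂Z∩PZ {k} {j} j≢k e =
          joinVertex-only P₂-off (j≢k ∘ sym) (subst (_∈ P₂Z k) on-vertex (meet-∈ˡ (P₂Z≢side k)))
          where
          side≢PZ = ≢-line (x∈joinVertex P-off j) (P-off k) ∘ sym
          on-vertex = unique-point side≢PZ (P₂Z∩side∈side k) (subst (_∈ PZ j) (sym e) (P₂Z∩PZ∈PZ k j))
                                   (vertex-∈-side j≢k) (vertex∈joinVertex P-off j)

        P₂≢P₂Z∩PZ : ∀ k j → P₂ ≢ P₂Z∩PZ k j
        P₂≢P₂Z∩PZ k j e = ℓ-miss j (subst (vertex j ∈_) PZ≡ℓ (vertex∈joinVertex P-off j))
          where PZ≡ℓ = unique-line (P₂≢P ∘ sym) (x∈joinVertex P-off j) (subst (_∈ PZ j) (sym e) (P₂Z∩PZ∈PZ k j))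
                                   P∈ℓ P₂∈ℓ

        P₂Z∩PZ-injective : ∀ {k i j} → i ≢ j → P₂Z∩PZ k i ≢ P₂Z∩PZ k j
        P₂Z∩PZ-injective {k} {i} {j} i≢j e = P∉P₂Z k (subst (_∈ P₂Z k) on-P (meet-∈ˡ (P₂Z≢PZ k i)))
          where on-P = unique-point (joinVertex-injective P-off i≢j) (P₂Z∩PZ∈PZ k i)
                                    (subst (_∈ PZ j) (sym e) (P₂Z∩PZ∈PZ k j)) (x∈joinVertex P-off i) (x∈joinVertex P-off j)

      blockingPoints-size : ∀ k → Fin (q ∸ 4) ↔ Σ Point (T ∘ blockingPoint? k)
      blockingPoints-size k =
        ↔-remove _≟_ (excluded k) excluded-unique excluded-on (λ _ → mk⇔ toWitness fromWitness) (pointsOn (P₂Z k))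
        where
        excluded-on : All (_∈ P₂Z k) (excluded k)
        excluded-on = vertex∈joinVertex P₂-off k ∷ meet-∈ˡ (P₂Z≢side k) ∷ x∈joinVertex P₂-off k
                    ∷ meet-∈ˡ (P₂Z≢PZ k (next k)) ∷ meet-∈ˡ (P₂Z≢PZ k (prev k)) ∷ []
        excluded-unique : Unique (excluded k)
        excluded-unique =
            ( ≢-point (P₂Z∩side∈side k) (vertex-∉-side k) ∘ sym ∷ offSides⇒≢vertex P₂-off k ∘ sym
            ∷ vertex≢P₂Z∩PZ (next≢ k) ∷ vertex≢P₂Z∩PZ (prev≢ k) ∷ [])
          ∷ ( ≢-point (P₂Z∩side∈side k) (P₂-off k)
            ∷ P₂Z∩side≢P₂Z∩PZ (next≢ k) ∷ P₂Z∩side≢P₂Z∩PZ (prev≢ k) ∷ [])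
          ∷ (P₂≢P₂Z∩PZ k (next k) ∷ P₂≢P₂Z∩PZ k (prev k) ∷ [])
          ∷ (P₂Z∩PZ-injective (next≢prev k) ∷ []) ∷ [] ∷ []

      Blocking : Set
      Blocking = Σ (Fin 3) (λ k → Σ Point (T ∘ blockingPoint? k))

      private
        index-unique : ∀ {k k′ X} → X ≢ P₂ → X ∈ P₂Z k → X ∈ P₂Z k′ → k ≡ k′
        index-unique {k} {k′} X≢P₂ X∈P₂Z X∈P₂Z′ = decidable-stable (k ≟ k′) λ k≢k′ →
          joinVertex-injective P₂-off k≢k′
          (unique-line (X≢P₂ ∘ sym) (x∈joinVertex P₂-off k) X∈P₂Z (x∈joinVertex P₂-off k′) X∈P₂Z′)

        Blocking-≡ : ∀ {k k′ X} {b : T (blockingPoint? k X)} {b′ : T (blockingPoint? k′ X)} →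
                     k ≡ k′ → _≡_ {A = Blocking} (k , X , b) (k′ , X , b′)
        Blocking-≡ {b = b} {b′} refl = cong (λ r → _ , _ , r) (T-irrelevant b b′)

        Closing-≡ : ∀ {m m′ X} {o : T (otherLine? m)} {o′ : T (otherLine? m′)} {t t′} →
                    m ≡ m′ → _≡_ {A = Closing} ((m , o) , X , t) ((m′ , o′) , X , t′)
        Closing-≡ {o = o} {o′} {t} {t′} refl = cong₂ (λ r s → (_ , r) , _ , s) (T-irrelevant o o′) (T-irrelevant t t′)

        All-five : ∀ {A : Set} {R : A → Set} {a b c d e} →
                   All R (a ∷ b ∷ c ∷ d ∷ e ∷ []) → R a × R b × R c × R d × R e
        All-five (ra ∷ rb ∷ rc ∷ rd ∷ re ∷ []) = ra , rb , rc , rd , re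

        module FromBlocking {k X} (b : T (blockingPoint? k X)) where
          X∈P₂Z : X ∈ P₂Z k
          X∈P₂Z = proj₁ (toWitness b)
          X≢Z   = proj₁ (All-five (proj₂ (toWitness b)))
          X≢P₂Z∩side = proj₁ (proj₂ (All-five (proj₂ (toWitness b))))
          X≢P₂ = proj₁ (proj₂ (proj₂ (All-five (proj₂ (toWitness b)))))
          X≢P₂Z∩PZ₁ = proj₁ (proj₂ (proj₂ (proj₂ (All-five (proj₂ (toWitness b))))))
          X≢P₂Z∩PZ₂ = proj₂ (proj₂ (proj₂ (proj₂ (All-five (proj₂ (toWitness b))))))
          P≢X = ≢-point X∈P₂Z (P∉P₂Z k) ∘ sym

          X-off : OffSides X
          X-off j X∈j with j ≟ k
          ... | yes refl = X≢P₂Z∩side (meet-unique (P₂Z≢side k) X∈P₂Z X∈j)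
          ... | no j≢k = P₂-off j (subst (P₂ ∈_) P₂Z≡side (x∈joinVertex P₂-off k))
            where P₂Z≡side = unique-line X≢Z X∈P₂Z (vertex∈joinVertex P₂-off k) X∈j (vertex-∈-side (j≢k ∘ sym))

          PX-misses : MissesVertices (join P X)
          PX-misses j j∈PX with self-next-or-prev k j | joinVertex-unique P-off (join-∈ˡ P≢X) j∈PX
          ... | inj₁ refl        | _ = P∉P₂Z k (subst (P ∈_) PX≡P₂Z (join-∈ˡ P≢X))
            where PX≡P₂Z = unique-line X≢Z (join-∈ʳ P≢X) j∈PX X∈P₂Z (vertex∈joinVertex P₂-off k)
          ... | inj₂ (inj₁ refl) | PX≡PZ =
            X≢P₂Z∩PZ₁ (meet-unique (P₂Z≢PZ k j) X∈P₂Z (subst (X ∈_) PX≡PZ (join-∈ʳ P≢X)))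
          ... | inj₂ (inj₂ refl) | PX≡PZ =
            X≢P₂Z∩PZ₂ (meet-unique (P₂Z≢PZ k j) X∈P₂Z (subst (X ∈_) PX≡PZ (join-∈ʳ P≢X)))

          PX≢ℓ : join P X ≢ ℓ
          PX≢ℓ e = ℓ-miss k (subst (vertex k ∈_) P₂Z≡ℓ (vertex∈joinVertex P₂-off k))
            where P₂Z≡ℓ = unique-line X≢P₂ X∈P₂Z (x∈joinVertex P₂-off k) (subst (X ∈_) e (join-∈ʳ P≢X)) P₂∈ℓ

          PX-other : T (otherLine? (join P X))
          PX-other = Equivalence.from (otherLine⇔ {join P X}) (PX-misses , join-∈ˡ P≢X , PX≢ℓ)

          X∈PX-other : T (otherPointOn? (join P X) X)
          X∈PX-other = Equivalence.from (otherPointOn⇔ {join P X} {X}) (X-off , join-∈ʳ P≢X , P≢X ∘ sym)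

          blocked : T (blocked? P₂ ((join P X , PX-other) , X , X∈PX-other))
          blocked = fromWitnessFalse λ miss →
            miss k (subst (vertex k ∈_) (join-unique (X≢P₂ ∘ sym) (x∈joinVertex P₂-off k) X∈P₂Z)
                          (vertex∈joinVertex P₂-off k))

        closing : Blocking → Σ Closing (T ∘ blocked? P₂)
        closing (k , X , b) = ((join P X , PX-other) , X , X∈PX-other) , blocked
          where open FromBlocking b

        module _ {m X} (o : T (otherLine? m)) (t : T (otherPointOn? m X)) (bl : T (blocked? P₂ ((m , o) , X , t))) where
          private
            m-miss = proj₁ (Equivalence.to (otherLine⇔ {m}) o)
            P∈m = proj₁ (proj₂ (Equivalence.to (otherLine⇔ {m}) o))
            m≢ℓ = proj₂ (proj₂ (Equivalence.to (otherLine⇔ {m}) o))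
            X-off = proj₁ (Equivalence.to (otherPointOn⇔ {m} {X}) t)
            X∈m = proj₁ (proj₂ (Equivalence.to (otherPointOn⇔ {m} {X}) t))
            X≢P = proj₂ (proj₂ (Equivalence.to (otherPointOn⇔ {m} {X}) t))

          P₂≢X : P₂ ≢ X
          P₂≢X e = m≢ℓ (unique-line P₂≢P (subst (_∈ m) (sym e) X∈m) P∈m P₂∈ℓ P∈ℓ)

          blockingIndex : Fin 3
          blockingIndex = proj₁ (vertexOn (toWitnessFalse bl))

          X∈blockingLine : X ∈ P₂Z blockingIndex
          X∈blockingLine =
            subst (X ∈_) (joinVertex-unique P₂-off (join-∈ˡ P₂≢X) (proj₂ (vertexOn (toWitnessFalse bl)))) (join-∈ʳ P₂≢X)

          blockingPoint : T (blockingPoint? blockingIndex X)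
          blockingPoint = fromWitness (X∈blockingLine , exclusions)
            where
            k = blockingIndex
            X≢P₂Z∩PZ : ∀ j → X ≢ P₂Z∩PZ k j
            X≢P₂Z∩PZ j e = m-miss j (subst (vertex j ∈_) (sym m≡PZ) (vertex∈joinVertex P-off j))
              where m≡PZ = unique-line X≢P X∈m P∈m (subst (_∈ PZ j) (sym e) (P₂Z∩PZ∈PZ k j)) (x∈joinVertex P-off j)
            exclusions : All (X ≢_) (excluded k)
            exclusions = offSides⇒≢vertex X-off k ∷ (λ e → X-off k (subst (_∈ side k) (sym e) (P₂Z∩side∈side k)))
                       ∷ P₂≢X ∘ sym ∷ X≢P₂Z∩PZ (next k) ∷ X≢P₂Z∩PZ (prev k) ∷ []

          PX≡m : join P X ≡ m
          PX≡m = sym (join-unique (X≢P ∘ sym) P∈m X∈m)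

        blocking : Σ Closing (T ∘ blocked? P₂) → Blocking
        blocking (((m , o) , X , t) , bl) = blockingIndex o t bl , X , blockingPoint o t bl

        closing∘blocking : ∀ z → closing (blocking z) ≡ z
        closing∘blocking (((m , o) , X , t) , bl) = Σ-T-≡ (Closing-≡ (PX≡m o t bl))

        blocking∘closing : ∀ z → blocking (closing z) ≡ z
        blocking∘closing (k , X , b) =
          Blocking-≡ (sym (index-unique X≢P₂ X∈P₂Z (X∈blockingLine PX-other X∈PX-other blocked)))
          where open FromBlocking b

      blocked-closings↔ : Blocking ↔ Σ Closing (T ∘ blocked? P₂)
      blocked-closings↔ = mk↔ₛ′ closing blocking closing∘blocking blocking∘closing

    HexagonData : Set
    HexagonData = Σ SecondPoint (λ P₂ → Σ Closing (T ∘ not ∘ blocked? (proj₁ P₂)))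

    HexagonData-size : Fin ((q ∸ 3) * ((q ∸ 3) * (q ∸ 3) ∸ 3 * (q ∸ 4))) ↔ HexagonData
    HexagonData-size = Σ-size SecondPoint-size λ (P₂ , w) → ↔-complement (blocked? P₂) Closing-size
      (↔-trans (Σ-size ↔-refl (Blocked.blockingPoints-size w)) (Blocked.blocked-closings↔ w))

    private
      a₀ b₀ : Vertex
      a₀ = inj₁ (P , p)
      b₀ = inj₂ (ℓ , pℓ)

      point≢ : ∀ {x y} {px : T (offSides? x)} {py : T (offSides? y)} →
               x ≢ y → _≢_ {A = Vertex} (inj₁ (x , px)) (inj₁ (y , py))
      point≢ x≢y refl = x≢y refl

      line≢ : ∀ {l m} {pl : T (missesVertices? l)} {pm : T (missesVertices? m)} →
              l ≢ m → _≢_ {A = Vertex} (inj₂ (l , pl)) (inj₂ (m , pm))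
      line≢ l≢m refl = l≢m refl

      ≢point : ∀ {x y} {px : T (offSides? x)} {py : T (offSides? y)} →
               _≢_ {A = Vertex} (inj₁ (x , px)) (inj₁ (y , py)) → x ≢ y
      ≢point ne refl = ne (cong (λ r → inj₁ (_ , r)) (T-irrelevant _ _))

      ≢line : ∀ {l m} {pl : T (missesVertices? l)} {pm : T (missesVertices? m)} →
              _≢_ {A = Vertex} (inj₂ (l , pl)) (inj₂ (m , pm)) → l ≢ m
      ≢line ne refl = ne (cong (λ r → inj₂ (_ , r)) (T-irrelevant _ _))

      HexagonData-≡ : ∀ {P₂ m P₃} {w w′ o o′ t t′ g g′} →
                      _≡_ {A = HexagonData} ((P₂ , w) , ((m , o) , P₃ , t) , g) ((P₂ , w′) , ((m , o′) , P₃ , t′) , g′)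
      HexagonData-≡ {w = w} {w′} {o} {o′} {t} {t′} {g} {g′}
        rewrite T-irrelevant w w′ | T-irrelevant o o′ | T-irrelevant t t′ | T-irrelevant g g′ = refl

    module ToHexagon {P₂} (w : T (otherPointOn? ℓ P₂)) {m} (o : T (otherLine? m)) {P₃} (t : T (otherPointOn? m P₃))
                     (good : T (not (blocked? P₂ ((m , o) , P₃ , t)))) where

      private
        P₂-off = proj₁ (Equivalence.to (otherPointOn⇔ {ℓ} {P₂}) w)
        P₂∈ℓ = proj₁ (proj₂ (Equivalence.to (otherPointOn⇔ {ℓ} {P₂}) w))
        P₂≢P = proj₂ (proj₂ (Equivalence.to (otherPointOn⇔ {ℓ} {P₂}) w))
        m-miss = proj₁ (Equivalence.to (otherLine⇔ {m}) o)
        P∈m = proj₁ (proj₂ (Equivalence.to (otherLine⇔ {m}) o))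
        m≢ℓ = proj₂ (proj₂ (Equivalence.to (otherLine⇔ {m}) o))
        P₃-off = proj₁ (Equivalence.to (otherPointOn⇔ {m} {P₃}) t)
        P₃∈m = proj₁ (proj₂ (Equivalence.to (otherPointOn⇔ {m} {P₃}) t))
        P₃≢P = proj₂ (proj₂ (Equivalence.to (otherPointOn⇔ {m} {P₃}) t))
        P₂∉m : P₂ ∉ m
        P₂∉m P₂∈m = m≢ℓ (unique-line P₂≢P P₂∈m P∈m P₂∈ℓ P∈ℓ)
        P₂≢P₃ = ≢-point P₃∈m P₂∉m ∘ sym
        ℓ≢n : ℓ ≢ join P₂ P₃
        ℓ≢n e = m≢ℓ (unique-line P₃≢P P₃∈m P∈m (subst (P₃ ∈_) (sym e) (join-∈ʳ P₂≢P₃)) P∈ℓ)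
        n≢m = ≢-line (join-∈ˡ P₂≢P₃) P₂∉m

      quadruple : Vertex × Vertex × Vertex × Vertex
      quadruple = inj₁ (P₂ , fromWitness P₂-off) , inj₂ (join P₂ P₃ , subst T (not-involutive _) good)
                , inj₁ (P₃ , fromWitness P₃-off) , inj₂ (m , fromWitness m-miss)

      hexagon : Hexagon a₀ b₀ quadruple
      hexagon =
        ( ((λ ()) ∷ point≢ (P₂≢P ∘ sym) ∷ (λ ()) ∷ point≢ (P₃≢P ∘ sym) ∷ (λ ()) ∷ [])
        ∷ ((λ ()) ∷ line≢ ℓ≢n ∷ (λ ()) ∷ line≢ (m≢ℓ ∘ sym) ∷ [])
        ∷ ((λ ()) ∷ point≢ P₂≢P₃ ∷ (λ ()) ∷ [])
        ∷ ((λ ()) ∷ line≢ n≢m ∷ []) ∷ ((λ ()) ∷ []) ∷ [] ∷ [])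
        , P∈ℓ ∷ P₂∈ℓ ∷ join-∈ˡ P₂≢P₃ ∷ join-∈ʳ P₂≢P₃ ∷ P₃∈m ∷ [-] , P∈m

    private
      record HexagonFacts (a b c d e f : Vertex) : Set where
        field
          a≢c : a ≢ c
          a≢e : a ≢ e
          b≢f : b ≢ f
          c≢e : c ≢ e
          b~c : b ~ c
          c~d : c ~ d
          d~e : d ~ e
          e~f : e ~ f
          f~a : f ~ a

      hexagon-facts : ∀ {a b c d e f} → Hexagon a b (c , d , e , f) → HexagonFacts a b c d e f
      hexagon-facts ( ((_ ∷ a≢c ∷ _ ∷ a≢e ∷ _ ∷ []) ∷ (_ ∷ _ ∷ _ ∷ b≢f ∷ []) ∷ (_ ∷ c≢e ∷ _ ∷ []) ∷ _)
                    , _ ∷ b~c ∷ c~d ∷ d~e ∷ e~f ∷ [-] , f~a) = record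
        { a≢c = a≢c ; a≢e = a≢e ; b≢f = b≢f ; c≢e = c≢e
        ; b~c = b~c ; c~d = c~d ; d~e = d~e ; e~f = e~f ; f~a = f~a }

    fromHexagon : ∀ c d e f → Hexagon a₀ b₀ (c , d , e , f) → HexagonData
    fromHexagon (inj₂ _) _ _ _ h = ⊥-elim (HexagonFacts.b~c (hexagon-facts h))
    fromHexagon (inj₁ _) (inj₁ _) _ _ h = ⊥-elim (HexagonFacts.c~d (hexagon-facts h))
    fromHexagon (inj₁ _) (inj₂ _) (inj₂ _) _ h = ⊥-elim (HexagonFacts.d~e (hexagon-facts h))
    fromHexagon (inj₁ _) (inj₂ _) (inj₁ _) (inj₁ _) h = ⊥-elim (HexagonFacts.e~f (hexagon-facts h))
    fromHexagon (inj₁ (P₂ , p₂)) (inj₂ (n , pn)) (inj₁ (P₃ , p₃)) (inj₂ (m , pm)) h =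
      (P₂ , Equivalence.from otherPointOn⇔ (toWitness p₂ , b~c , ≢point a≢c ∘ sym)) ,
      ((m , Equivalence.from otherLine⇔ (toWitness pm , f~a , ≢line b≢f ∘ sym)) ,
       P₃ , Equivalence.from otherPointOn⇔ (toWitness p₃ , e~f , ≢point a≢e ∘ sym)) ,
      subst T (sym (not-involutive _)) (subst (T ∘ missesVertices?) (join-unique (≢point c≢e) c~d d~e) pn)
      where open HexagonFacts (hexagon-facts h)

    private
      quadruple-≡ : ∀ {P₂ n n′ P₃ m} {p₂ p₂′ pn pn′ p₃ p₃′ pm pm′} → n′ ≡ n →
                    _≡_ {A = Vertex × Vertex × Vertex × Vertex}
                        (inj₁ (P₂ , p₂′) , inj₂ (n′ , pn′) , inj₁ (P₃ , p₃′) , inj₂ (m , pm′))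
                        (inj₁ (P₂ , p₂) , inj₂ (n , pn) , inj₁ (P₃ , p₃) , inj₂ (m , pm))
      quadruple-≡ {p₂ = p₂} {p₂′} {pn} {pn′} {p₃} {p₃′} {pm} {pm′} refl
        rewrite T-irrelevant p₂ p₂′ | T-irrelevant pn pn′ | T-irrelevant p₃ p₃′ | T-irrelevant pm pm′ = refl

    HexagonData↔Hexagons : HexagonData ↔ Hexagons _≟ᵛ_ a₀ b₀
    HexagonData↔Hexagons = mk↔ₛ′ toHexagons fromHexagons toHexagons∘fromHexagons (λ _ → HexagonData-≡)
      where
      toHexagons : HexagonData → Hexagons _≟ᵛ_ a₀ b₀
      toHexagons ((_ , w) , ((_ , o) , _ , t) , good) =
        ToHexagon.quadruple w o t good ,
        hexagon-evidence _≟ᵛ_ a₀ b₀ (ToHexagon.quadruple w o t good) (ToHexagon.hexagon w o t good)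
      fromHexagons : Hexagons _≟ᵛ_ a₀ b₀ → HexagonData
      fromHexagons ((c , d , e , f) , h) = fromHexagon c d e f (hexagon-witness _≟ᵛ_ a₀ b₀ _ h)
      toHexagons∘fromHexagons : ∀ z → toHexagons (fromHexagons z) ≡ z
      toHexagons∘fromHexagons ((inj₂ _ , _ , _ , _) , h) =
        ⊥-elim (HexagonFacts.b~c (hexagon-facts (hexagon-witness _≟ᵛ_ a₀ b₀ _ h)))
      toHexagons∘fromHexagons ((inj₁ _ , inj₁ _ , _ , _) , h) =
        ⊥-elim (HexagonFacts.c~d (hexagon-facts (hexagon-witness _≟ᵛ_ a₀ b₀ _ h)))
      toHexagons∘fromHexagons ((inj₁ _ , inj₂ _ , inj₂ _ , _) , h) =
        ⊥-elim (HexagonFacts.d~e (hexagon-facts (hexagon-witness _≟ᵛ_ a₀ b₀ _ h)))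
      toHexagons∘fromHexagons ((inj₁ _ , inj₂ _ , inj₁ _ , inj₁ _) , h) =
        ⊥-elim (HexagonFacts.e~f (hexagon-facts (hexagon-witness _≟ᵛ_ a₀ b₀ _ h)))
      toHexagons∘fromHexagons ((inj₁ _ , inj₂ _ , inj₁ _ , inj₂ _) , h) =
        Σ-T-≡ (quadruple-≡ (sym (join-unique (≢point c≢e) c~d d~e)))
        where open HexagonFacts (hexagon-facts (hexagon-witness _≟ᵛ_ a₀ b₀ _ h))

  hexagon-count : ∀ u v → u ~ v → Fin ((q ∸ 3) * ((q ∸ 3) * (q ∸ 3) ∸ 3 * (q ∸ 4))) ↔ Hexagons _≟ᵛ_ u v
  hexagon-count (inj₁ (P , p)) (inj₂ (ℓ , pℓ)) P∈ℓ = ↔-trans HexagonData-size HexagonData↔Hexagons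
    where open HexagonCount p pℓ P∈ℓ
  hexagon-count (inj₂ (ℓ , pℓ)) (inj₁ (P , p)) P∈ℓ =
    ↔-trans (↔-trans HexagonData-size HexagonData↔Hexagons) (Hexagons-reverse _≟ᵛ_ (inj₁ (P , p)) (inj₂ (ℓ , pℓ)))
    where open HexagonCount p pℓ P∈ℓ

  cycles-through-edge : ∀ u v → T (adj graph u v) →
                        Fin ((q ∸ 3) * ((q ∸ 3) * (q ∸ 3) ∸ 3 * (q ∸ 4))) ↔ CyclesThrough graph 6 u v
  cycles-through-edge u v u~v =
    ↔-trans (hexagon-count (to Vertex-size u) (to Vertex-size v) u~v) (Hexagons↔CyclesThrough _≟ᵛ_ u v)

-- Planes of order q > 4

[2+r]²∸3[1+r]≡1+r²+r : ∀ r → (2 + r) * (2 + r) ∸ 3 * (1 + r) ≡ suc (r * r + r)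
[2+r]²∸3[1+r]≡1+r²+r r = begin
  (2 + r) * (2 + r) ∸ 3 * (1 + r)                   ≡⟨ cong (_∸ 3 * (1 + r)) (expand r) ⟩
  suc (r * r + r) + 3 * (1 + r) ∸ 3 * (1 + r)       ≡⟨ m+n∸n≡m (suc (r * r + r)) (3 * (1 + r)) ⟩
  suc (r * r + r)                                   ∎
  where
  open ≡-Reasoning
  expand : ∀ r → (2 + r) * (2 + r) ≡ suc (r * r + r) + 3 * (1 + r)
  expand = solve-∀

[5+r]²+21∸9[5+r]≡1+r²+r : ∀ r → (5 + r) * (5 + r) + 21 ∸ 9 * (5 + r) ≡ suc (r * r + r)
[5+r]²+21∸9[5+r]≡1+r²+r r = begin
  (5 + r) * (5 + r) + 21 ∸ 9 * (5 + r)              ≡⟨ cong (_∸ 9 * (5 + r)) (expand r) ⟩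
  suc (r * r + r) + 9 * (5 + r) ∸ 9 * (5 + r)       ≡⟨ m+n∸n≡m (suc (r * r + r)) (9 * (5 + r)) ⟩
  suc (r * r + r)                                   ∎
  where
  open ≡-Reasoning
  expand : ∀ r → (5 + r) * (5 + r) + 21 ≡ suc (r * r + r) + 9 * (5 + r)
  expand = solve-∀

module OrderAbove4 (r : ℕ) (Π : ProjectivePlane (5 + r)) where

  open IncidenceGraph Π

  edge-cycles : ∀ u v → T (adj graph u v) →
                Fin ((2 + r) * ((5 + r) * (5 + r) + 21 ∸ 9 * (5 + r))) ↔ CyclesThrough graph 6 u v
  edge-cycles u v u~v = subst (λ n → Fin ((2 + r) * n) ↔ CyclesThrough graph 6 u v)
    (trans ([2+r]²∸3[1+r]≡1+r²+r r) (sym ([5+r]²+21∸9[5+r]≡1+r²+r r))) (cycles-through-edge u v u~v)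

  has-6-cycle : HasCycle graph 6
  has-6-cycle =
    s≤s (s≤s (s≤s z≤n)) , proj₁ cycle , proj₂ (∧-elim {startsWith u v (toList (proj₁ cycle))} (proj₂ cycle))
    where
    u = zero
    v = proj₁ (to (regular degree u) zero)
    cycle = to (subst (λ n → Fin ((2 + r) * n) ↔ CyclesThrough graph 6 u v) ([2+r]²∸3[1+r]≡1+r²+r r)
                      (cycles-through-edge u v (proj₂ (to (regular degree u) zero)))) zero

  no-short-cycle : ∀ m → 3 ≤ m → m < 6 → ¬ HasCycle graph m
  no-short-cycle 3 _ _ = bipartite⇒¬3-cycle graph (bipartite isPoint isPoint-proper)
  no-short-cycle 4 _ _ = ¬4-cycle at-most-one-common-neighbour
  no-short-cycle 5 _ _ = bipartite⇒¬5-cycle graph (bipartite isPoint isPoint-proper)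
  no-short-cycle (suc (suc (suc (suc (suc (suc _)))))) _ (s≤s (s≤s (s≤s (s≤s (s≤s (s≤s ())))))) _
  no-short-cycle 1 (s≤s ()) _
  no-short-cycle 2 (s≤s (s≤s ())) _

theorem2p5 : (q : ℕ) → 4 < q → ProjectivePlane q →
    Σ (Graph (2 * ((q ∸ 1) * (q ∸ 1)))) (λ G →
      IsBipartite G ×
      IsEGR (2 * ((q ∸ 1) * (q ∸ 1))) G (q ∸ 2) 6 ((q ∸ 3) * (q * q + 21 ∸ 9 * q)))
theorem2p5 (suc (suc (suc (suc (suc r))))) q>4 Π =
  graph , bipartite isPoint isPoint-proper ,
  connected (walk q>4) , regular degree , (has-6-cycle , no-short-cycle) , edge-cycles
  where open OrderAbove4 r Π
        open IncidenceGraph Π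
theorem2p5 0 () _
theorem2p5 1 (s≤s ()) _
theorem2p5 2 (s≤s (s≤s ())) _
theorem2p5 3 (s≤s (s≤s (s≤s ()))) _
theorem2p5 4 (s≤s (s≤s (s≤s (s≤s ())))) _
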